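{- The category $\mathbb{M}$, together with its exponentiable object $\langle0\rangle$, is initial amongst cartesian categories equipped with an exponentiable object, with respect to cartesian functors that preserve the exponentiable object.
   Context: $\mathbb{M}$: objects are finite sequences $\langle m_1,\dots,m_k\rangle\in\mathbb{N}^*$; a morphism $\langle m_1,\dots,m_k\rangle\to\langle n_1,\dots,n_\ell\rangle$ is a tuple $\langle t_1,\dots,t_\ell\rangle$ where each $t_i$ is a second-order term over the empty signature in context $\mathsf{m}_1:[m_1],\dots,\mathsf{m}_k:[m_k]\rhd x_1,\dots,x_{n_i}$, i.e. generated by the variables $x_j$ and metavariable applications $\mathsf{m}_i[s_1,\dots,s_{m_i}]$ (metavariable $\mathsf{m}_i$ has arity $m_i$). Identities are $\langle\mathsf{m}_i[x_1,\dots,x_{m_i}]\rangle_{i}$; the composite of $\langle s_p\rangle_{p\le j}:\langle l_1,\dots,l_i\rangle\to\langle m_1,\dots,m_j\rangle$ and $\langle t_q\rangle_{q\le k}:\langle m_1,\dots,m_j\rangle\to\langle n_1,\dots,n_k\rangle$ is $\langle t_q\{\mathsf{m}_p:=(x_1,\dots,x_{m_p})s_p\}_{p}\rangle_q$, where metasubstitution replaces each occurrence $\mathsf{m}_p[u_1,\dots,u_{m_p}]$ by $s_p$ with $x_r$ substituted by the (recursively metasubstituted) $u_r$. $\mathbb{M}$ is strict cartesian, with terminal object the empty sequence and binary products given by concatenation, and $\langle0\rangle$ is exponentiable: $\langle0\rangle\Rightarrow\langle m_1,\dots,m_k\rangle=\langle m_1+1,\dots,m_k+1\rangle$ with evaluation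 map $\langle m_1+1,\dots,m_k+1,0\rangle\to\langle m_1,\dots,m_k\rangle$ given by $\langle\mathsf{m}_i[x_1,\dots,x_{m_i},\mathsf{m}_{k+1}[\,]]\rangle_{i\le k}$. -}

module Defs where

open import Level using (Level; _⊔_; suc; zero)
open import Agda.Primitive using (Setω)
open import Data.Nat using (ℕ) renaming (suc to 1+)
open import Data.Fin using (Fin)
open import Data.Vec using (Vec; []; _∷_; _∷ʳ_) renaming (tabulate to vtabulate; lookup to vlookup)
open import Data.List using (List; []; _∷_; _++_; map)
open import Data.List.Membership.Propositional using (_∈_)
open import Data.List.Membership.Propositional.Properties using (∈-map⁺; ∈-++⁺ˡ; ∈-++⁺ʳ)
open import Data.List.Relation.Unary.Any using (here)
open import Data.List.Relation.Unary.All using (All) renaming (tabulate to atabulate; lookup to alookup; map to amap)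
open import Data.Product using (Σ; _×_; _,_; proj₁)
open import Relation.Binary using (Rel; IsEquivalence)
open import Relation.Binary.PropositionalEquality using (_≡_; refl)

record RawCategory (o ℓ e : Level) : Set (Level.suc (o ⊔ ℓ ⊔ e)) where
  infixr 9 _∘_
  infix  4 _≈_
  field
    Obj : Set o
    _⇒_ : Obj → Obj → Set ℓ
    _≈_ : ∀ {A B} → Rel (A ⇒ B) e
    id  : ∀ {A} → A ⇒ A
    _∘_ : ∀ {A B C} → B ⇒ C → A ⇒ B → A ⇒ C

module _ {o ℓ e} (C : RawCategory o ℓ e) where
  open RawCategory C

  record IsCategory : Set (o ⊔ ℓ ⊔ e) where
    field
      equiv     : ∀ {A B} → IsEquivalence (_≈_ {A} {B})
      ∘-resp-≈  : ∀ {A B D} {f h : B ⇒ D} {g i : A ⇒ B} → f ≈ h → g ≈ i → f ∘ g ≈ h ∘ i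
      identityˡ : ∀ {A B} {f : A ⇒ B} → id ∘ f ≈ f
      identityʳ : ∀ {A B} {f : A ⇒ B} → f ∘ id ≈ f
      assoc     : ∀ {A B D E} {f : A ⇒ B} {g : B ⇒ D} {h : D ⇒ E} →
                  (h ∘ g) ∘ f ≈ h ∘ (g ∘ f)

  IsTerminal : Obj → Set (o ⊔ ℓ ⊔ e)
  IsTerminal T = ∀ Z → Σ (Z ⇒ T) λ ! → ∀ (h : Z ⇒ T) → h ≈ !

  IsProduct : (A B P : Obj) → P ⇒ A → P ⇒ B → Set (o ⊔ ℓ ⊔ e)
  IsProduct A B P p₁ p₂ =
    ∀ {Z} (f : Z ⇒ A) (g : Z ⇒ B) →
      Σ (Z ⇒ P) λ h → (p₁ ∘ h ≈ f) × (p₂ ∘ h ≈ g) ×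
        (∀ (h′ : Z ⇒ P) → p₁ ∘ h′ ≈ f → p₂ ∘ h′ ≈ g → h′ ≈ h)

  -- E together with  ev : P → B  (where (P, p₁, p₂) is a product of E and X)
  -- is an exponential  X ⇒ B : for every A and every product (Q, q₁, q₂) of A
  -- and X, every  f : Q → B  factors as  ev ∘ (g × X)  for a unique  g : A → E.
  -- Here "h = g × X" is expressed by  p₁ ∘ h ≈ g ∘ q₁  and  p₂ ∘ h ≈ q₂.
  IsExponential : (X B E P : Obj) → P ⇒ E → P ⇒ X → P ⇒ B → Set (o ⊔ ℓ ⊔ e)
  IsExponential X B E P p₁ p₂ ev =
    IsProduct E X P p₁ p₂ ×
    (∀ {A Q} (q₁ : Q ⇒ A) (q₂ : Q ⇒ X) → IsProduct A X Q q₁ q₂ →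
       ∀ (f : Q ⇒ B) →
       Σ (A ⇒ E) λ g → Factors q₁ q₂ f g ×
         (∀ (g′ : A ⇒ E) → Factors q₁ q₂ f g′ → g′ ≈ g))
    where
    Factors : ∀ {A Q} → Q ⇒ A → Q ⇒ X → Q ⇒ B → A ⇒ E → Set (ℓ ⊔ e)
    Factors {A} {Q} q₁ q₂ f g = ∀ (h : Q ⇒ P) → p₁ ∘ h ≈ g ∘ q₁ → p₂ ∘ h ≈ q₂ → ev ∘ h ≈ f

record RawCartExp (o ℓ e : Level) : Set (Level.suc (o ⊔ ℓ ⊔ e)) where
  field
    cat : RawCategory o ℓ e
  open RawCategory cat
  field
    ⊤    : Obj
    _×ₒ_ : Obj → Obj → Obj
    π₁   : ∀ {A B} → (A ×ₒ B) ⇒ A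
    π₂   : ∀ {A B} → (A ×ₒ B) ⇒ B
    X    : Obj
    X⇨_  : Obj → Obj
    eval : ∀ {B} → ((X⇨ B) ×ₒ X) ⇒ B

record IsCartExp {o ℓ e} (R : RawCartExp o ℓ e) : Set (o ⊔ ℓ ⊔ e) where
  open RawCartExp R
  open RawCategory cat
  field
    isCategory    : IsCategory cat
    terminal      : IsTerminal cat ⊤
    product       : ∀ A B → IsProduct cat A B (A ×ₒ B) π₁ π₂
    exponential   : ∀ B → IsExponential cat X B (X⇨ B) ((X⇨ B) ×ₒ X) π₁ π₂ eval

record CartExp (o ℓ e : Level) : Set (Level.suc (o ⊔ ℓ ⊔ e)) where
  field
    raw  : RawCartExp o ℓ e
    laws : IsCartExp raw
  open RawCartExp raw public

module _ {o ℓ e o′ ℓ′ e′} (C : CartExp o ℓ e) (D : CartExp o′ ℓ′ e′) where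
  private
    module C = CartExp C
    module D = CartExp D
    module CC = RawCategory C.cat
    module DD = RawCategory D.cat

  record CartExpFunctor : Set (o ⊔ ℓ ⊔ e ⊔ o′ ⊔ ℓ′ ⊔ e′) where
    field
      F₀       : CC.Obj → DD.Obj
      F₁       : ∀ {A B} → A CC.⇒ B → F₀ A DD.⇒ F₀ B
      F-resp-≈ : ∀ {A B} {f g : A CC.⇒ B} → f CC.≈ g → F₁ f DD.≈ F₁ g
      F-id     : ∀ {A} → F₁ (CC.id {A}) DD.≈ DD.id
      F-∘      : ∀ {A B E} {f : A CC.⇒ B} {g : B CC.⇒ E} →
                 F₁ (g CC.∘ f) DD.≈ F₁ g DD.∘ F₁ f
      pres-⊤   : IsTerminal D.cat (F₀ C.⊤)
      pres-×   : ∀ A B → IsProduct D.cat (F₀ A) (F₀ B) (F₀ (A C.×ₒ B))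
                           (F₁ C.π₁) (F₁ C.π₂)
      φ        : F₀ C.X DD.⇒ D.X
      φ⁻¹      : D.X DD.⇒ F₀ C.X
      φ-isoˡ   : φ⁻¹ DD.∘ φ DD.≈ DD.id
      φ-isoʳ   : φ DD.∘ φ⁻¹ DD.≈ DD.id
      pres-⇨   : ∀ B → IsExponential D.cat (F₀ C.X) (F₀ B) (F₀ (C.X⇨ B))
                           (F₀ ((C.X⇨ B) C.×ₒ C.X)) (F₁ C.π₁) (F₁ C.π₂)
                           (F₁ C.eval)

  record CartExpTransformation (F G : CartExpFunctor) : Set (o ⊔ ℓ ⊔ e ⊔ ℓ′ ⊔ e′) where
    private
      module F = CartExpFunctor F
      module G = CartExpFunctor G
    field
      η       : ∀ A → F.F₀ A DD.⇒ G.F₀ A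
      natural : ∀ {A B} (f : A CC.⇒ B) → η B DD.∘ F.F₁ f DD.≈ G.F₁ f DD.∘ η A
      pres-X  : G.φ DD.∘ η C.X DD.≈ F.φ

  _≈₂_ : ∀ {F G} → Rel (CartExpTransformation F G) (o ⊔ e′)
  α ≈₂ β = ∀ A → CartExpTransformation.η α A DD.≈ CartExpTransformation.η β A

-- bi-initiality: for every target there is a morphism, and between any two
-- morphisms there is exactly one 2-cell (so the hom-category is contractible,
-- i.e. initial up to a unique isomorphism).
IsInitial : CartExp Level.zero Level.zero Level.zero → Setω
IsInitial M = ∀ {o ℓ e} (C : CartExp o ℓ e) →
  CartExpFunctor M C ×
  (∀ (F G : CartExpFunctor M C) →
     Σ (CartExpTransformation M C F G) λ α →
       ∀ (β : CartExpTransformation M C F G) → _≈₂_ M C β α)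

-- metavariable contexts are lists of arities; a metavariable of arity m is
-- a membership proof  m ∈ Γ.  Tm Γ n: second-order terms over the empty
-- signature in context  Γ ▹ x₁,…,xₙ.
data Tm (Γ : List ℕ) (n : ℕ) : Set where
  var  : Fin n → Tm Γ n
  mvar : ∀ {m} → m ∈ Γ → Vec (Tm Γ n) m → Tm Γ n

-- morphisms ⟨m₁..mₖ⟩ → ⟨n₁..n_ℓ⟩ : tuples of terms t_i in context Γ ▹ x₁..x_{n_i}
MHom : List ℕ → List ℕ → Set
MHom Γ Δ = All (Tm Γ) Δ

mutual
  vsub : ∀ {Γ m n} → Tm Γ m → Vec (Tm Γ n) m → Tm Γ n
  vsub (var x)     us = vlookup us x
  vsub (mvar p ts) us = mvar p (vsubs ts us)

  vsubs : ∀ {Γ m n k} → Vec (Tm Γ m) k → Vec (Tm Γ n) m → Vec (Tm Γ n) k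
  vsubs []       us = []
  vsubs (t ∷ ts) us = vsub t us ∷ vsubs ts us

mutual
  msub : ∀ {Γ Δ n} → MHom Γ Δ → Tm Δ n → Tm Γ n
  msub σ (var x)     = var x
  msub σ (mvar p us) = vsub (alookup σ p) (msubs σ us)

  msubs : ∀ {Γ Δ n k} → MHom Γ Δ → Vec (Tm Δ n) k → Vec (Tm Γ n) k
  msubs σ []       = []
  msubs σ (u ∷ us) = msub σ u ∷ msubs σ us

vars : ∀ {Γ n} → Vec (Tm Γ n) n
vars = vtabulate var

𝕄cat : RawCategory Level.zero Level.zero Level.zero
𝕄cat = record
  { Obj = List ℕ
  ; _⇒_ = MHom
  ; _≈_ = _≡_
  ; id  = atabulate (λ p → mvar p vars)
  ; _∘_ = λ t s → amap (msub s) t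
  }

𝕄raw : RawCartExp Level.zero Level.zero Level.zero
𝕄raw = record
  { cat  = 𝕄cat
  ; ⊤    = []
  ; _×ₒ_ = _++_
  ; π₁   = atabulate (λ p → mvar (∈-++⁺ˡ p) vars)
  ; π₂   = λ {A} → atabulate (λ p → mvar (∈-++⁺ʳ A p) vars)
  ; X    = 0 ∷ []
  ; X⇨_  = map 1+
  ; eval = λ {B} → atabulate (λ p →
      mvar (∈-++⁺ˡ (∈-map⁺ 1+ p))
           (vars ∷ʳ mvar (∈-++⁺ʳ (map 1+ B) (here refl)) []))
  }

record 𝕄IsInitial : Setω where
  field
    laws    : IsCartExp 𝕄raw
    initial : IsInitial (record { raw = 𝕄raw ; laws = laws })

-- Objects of 𝕄 are products of the objects ⟨m⟩ (products are concatenation), and ⟨0⟩ ⇒ A is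
-- map suc A because a nullary metavariable appended to the context can be traded for one more
-- bound variable.  Given C with exponentiable X, send ⟨m⟩ to X ⇒ (X ⇒ ⋯ (X ⇒ X)) with
-- m arrows and a term to the currying of its meaning as iterated evaluation on generalized
-- elements; functoriality is the substitution lemma for this semantics.  Between two structure
-- preserving functors F, G a 2-cell is forced on ⟨0⟩ by the isomorphisms φ, on ⟨m+1⟩ by the
-- universal property of the exponential and elsewhere by products.  Its naturality follows,
-- by extensionality of iterated application, from the fact that any such functor sends a term
-- to the iterated application of its metavariables: this holds in 𝕄 and is transported along
-- the functor through a generic environment of fresh nullary metavariables.

module Submission where

open import Level using (_⊔_; 0ℓ)
open import Data.Nat using (ℕ; zero; suc)
open import Data.Fin using (Fin; zero; suc; fromℕ; inject₁)
open import Data.Vec as V using (Vec; []; _∷_; _∷ʳ_)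
open import Data.Vec.Properties using (lookup∘tabulate; tabulate∘lookup; lookup-map; init-∷ʳ; last-∷ʳ; map-∷ʳ)
open import Data.List as L using (List; []; _∷_; _++_)
open import Data.List.Membership.Propositional using (_∈_)
open import Data.List.Membership.Propositional.Properties using (∈-map⁺; ∈-++⁺ˡ; ∈-++⁺ʳ)
open import Data.List.Relation.Unary.Any using (here; there)
open import Data.List.Relation.Unary.All as All using (All; []; _∷_)
open import Data.List.Relation.Unary.All.Properties using (++⁺; map⁺) renaming (lookup-map to lookup-amap)
open import Data.Product using (Σ; _×_; _,_; proj₁; proj₂)
open import Relation.Binary using (IsEquivalence)
open import Relation.Binary.PropositionalEquality using (_≡_; refl; sym; trans; cong; cong₂; isEquivalence)
open import Defs

module CategoryProperties {o ℓ e} (C : RawCategory o ℓ e) (isC : IsCategory C) where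
  open RawCategory C public
  open IsCategory isC public

  refl≈ : ∀ {A B} {f : A ⇒ B} → f ≈ f
  refl≈ = IsEquivalence.refl equiv

  sym≈ : ∀ {A B} {f g : A ⇒ B} → f ≈ g → g ≈ f
  sym≈ = IsEquivalence.sym equiv

  trans≈ : ∀ {A B} {f g h : A ⇒ B} → f ≈ g → g ≈ h → f ≈ h
  trans≈ = IsEquivalence.trans equiv

  ≡⇒≈ : ∀ {A B} {f g : A ⇒ B} → f ≡ g → f ≈ g
  ≡⇒≈ refl = refl≈

  infixr 2 _≈⟨_⟩_
  infix 3 _∎
  infix 1 begin_

  begin_ : ∀ {A B} {f g : A ⇒ B} → f ≈ g → f ≈ g
  begin p = p

  _≈⟨_⟩_ : ∀ {A B} (f : A ⇒ B) {g h : A ⇒ B} → f ≈ g → g ≈ h → f ≈ h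
  f ≈⟨ p ⟩ q = trans≈ p q

  _∎ : ∀ {A B} (f : A ⇒ B) → f ≈ f
  f ∎ = refl≈

  ∘-resp-≈ˡ : ∀ {A B D} {f h : B ⇒ D} {g : A ⇒ B} → f ≈ h → f ∘ g ≈ h ∘ g
  ∘-resp-≈ˡ p = ∘-resp-≈ p refl≈

  ∘-resp-≈ʳ : ∀ {A B D} {f : B ⇒ D} {g i : A ⇒ B} → g ≈ i → f ∘ g ≈ f ∘ i
  ∘-resp-≈ʳ p = ∘-resp-≈ refl≈ p

  sym-assoc : ∀ {A B D E} {f : A ⇒ B} {g : B ⇒ D} {h : D ⇒ E} → h ∘ (g ∘ f) ≈ (h ∘ g) ∘ f
  sym-assoc = sym≈ assoc

  pullʳ : ∀ {A B D E} {f : A ⇒ B} {g : B ⇒ D} {h : D ⇒ E} {k : A ⇒ D} → g ∘ f ≈ k → (h ∘ g) ∘ f ≈ h ∘ k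
  pullʳ p = trans≈ assoc (∘-resp-≈ʳ p)

  pullˡ : ∀ {A B D E} {f : A ⇒ B} {g : B ⇒ D} {h : D ⇒ E} {k : B ⇒ E} → h ∘ g ≈ k → h ∘ (g ∘ f) ≈ k ∘ f
  pullˡ p = trans≈ sym-assoc (∘-resp-≈ˡ p)

  cancelˡ : ∀ {A B D} {f : A ⇒ B} {g : B ⇒ D} {h : D ⇒ B} → h ∘ g ≈ id → h ∘ (g ∘ f) ≈ f
  cancelˡ p = trans≈ (pullˡ p) identityˡ

  !-unique₂ : ∀ {T} → IsTerminal C T → ∀ {Z} (f g : Z ⇒ T) → f ≈ g
  !-unique₂ t f g = trans≈ (proj₂ (t _) f) (sym≈ (proj₂ (t _) g))

  module Product {A B P : Obj} {p₁ : P ⇒ A} {p₂ : P ⇒ B} (isP : IsProduct C A B P p₁ p₂) where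
    pair : ∀ {Z} → Z ⇒ A → Z ⇒ B → Z ⇒ P
    pair f g = proj₁ (isP f g)

    project₁ : ∀ {Z} {f : Z ⇒ A} {g : Z ⇒ B} → p₁ ∘ pair f g ≈ f
    project₁ {f = f} {g} = proj₁ (proj₂ (isP f g))

    project₂ : ∀ {Z} {f : Z ⇒ A} {g : Z ⇒ B} → p₂ ∘ pair f g ≈ g
    project₂ {f = f} {g} = proj₁ (proj₂ (proj₂ (isP f g)))

    unique : ∀ {Z} {f : Z ⇒ A} {g : Z ⇒ B} (h : Z ⇒ P) → p₁ ∘ h ≈ f → p₂ ∘ h ≈ g → h ≈ pair f g
    unique {f = f} {g} h = proj₂ (proj₂ (proj₂ (isP f g))) h

    unique′ : ∀ {Z} {h h′ : Z ⇒ P} → p₁ ∘ h ≈ p₁ ∘ h′ → p₂ ∘ h ≈ p₂ ∘ h′ → h ≈ h′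
    unique′ {h = h} {h′} e₁ e₂ = trans≈ (unique h e₁ e₂) (sym≈ (unique h′ refl≈ refl≈))

    pair-cong : ∀ {Z} {f f′ : Z ⇒ A} {g g′ : Z ⇒ B} → f ≈ f′ → g ≈ g′ → pair f g ≈ pair f′ g′
    pair-cong e₁ e₂ = unique _ (trans≈ project₁ e₁) (trans≈ project₂ e₂)

    pair-∘ : ∀ {Y Z} {f : Z ⇒ A} {g : Z ⇒ B} {k : Y ⇒ Z} → pair f g ∘ k ≈ pair (f ∘ k) (g ∘ k)
    pair-∘ = unique _ (pullˡ project₁) (pullˡ project₂)

  pair-irrelevant : ∀ {A B P} {p₁ : P ⇒ A} {p₂ : P ⇒ B} (isP isP′ : IsProduct C A B P p₁ p₂)
                    {Z} (f : Z ⇒ A) (g : Z ⇒ B) → Product.pair isP f g ≈ Product.pair isP′ f g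
  pair-irrelevant isP isP′ f g = Product.unique isP′ _ (Product.project₁ isP) (Product.project₂ isP)

  isProduct-iso₂ : ∀ {A B B′ P} {p₁ : P ⇒ A} {p₂ : P ⇒ B} (k : B ⇒ B′) (k⁻¹ : B′ ⇒ B) →
                   k⁻¹ ∘ k ≈ id → k ∘ k⁻¹ ≈ id →
                   IsProduct C A B P p₁ p₂ → IsProduct C A B′ P p₁ (k ∘ p₂)
  isProduct-iso₂ {p₁ = p₁} {p₂} k k⁻¹ k⁻¹k kk⁻¹ isP f g =
    pair f (k⁻¹ ∘ g) , project₁ , trans≈ (pullʳ project₂) (cancelˡ kk⁻¹) ,
    λ h e₁ e₂ → unique h e₁ (trans≈ (sym≈ (cancelˡ k⁻¹k)) (∘-resp-≈ʳ (trans≈ sym-assoc e₂)))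
    where open Product isP

  module Exponential {X B E P : Obj} {p₁ : P ⇒ E} {p₂ : P ⇒ X} {ev : P ⇒ B}
                     (isE : IsExponential C X B E P p₁ p₂ ev) where
    Factors : ∀ {A Q} → Q ⇒ A → Q ⇒ X → Q ⇒ B → A ⇒ E → Set (ℓ ⊔ e)
    Factors q₁ q₂ f g = ∀ (h : _ ⇒ P) → p₁ ∘ h ≈ g ∘ q₁ → p₂ ∘ h ≈ q₂ → ev ∘ h ≈ f

    module _ {A Q} {q₁ : Q ⇒ A} {q₂ : Q ⇒ X} (isQ : IsProduct C A X Q q₁ q₂) (f : Q ⇒ B) where
      transpose : A ⇒ E
      transpose = proj₁ (proj₂ isE q₁ q₂ isQ f)

      transpose-factors : Factors q₁ q₂ f transpose
      transpose-factors = proj₁ (proj₂ (proj₂ isE q₁ q₂ isQ f))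

      transpose-unique : ∀ g → Factors q₁ q₂ f g → g ≈ transpose
      transpose-unique = proj₂ (proj₂ (proj₂ isE q₁ q₂ isQ f))

  -- Universality against one chosen product A ⊗X for each A suffices, since any
  -- other product Q of A and X is isomorphic to it.
  module _ {X B E P : Obj} {p₁ : P ⇒ E} {p₂ : P ⇒ X} {ev : P ⇒ B}
           (isP : IsProduct C E X P p₁ p₂)
           (_⊗X : Obj → Obj) (ι₁ : ∀ {A} → (A ⊗X) ⇒ A) (ι₂ : ∀ {A} → (A ⊗X) ⇒ X)
           (isι : ∀ A → IsProduct C A X (A ⊗X) ι₁ ι₂)
           (curry : ∀ {A} → (A ⊗X) ⇒ B → A ⇒ E)
           (curry-β : ∀ {A} (f : (A ⊗X) ⇒ B) (h : (A ⊗X) ⇒ P) →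
                      p₁ ∘ h ≈ curry f ∘ ι₁ → p₂ ∘ h ≈ ι₂ → ev ∘ h ≈ f)
           (curry-unique : ∀ {A} (f : (A ⊗X) ⇒ B) (g : A ⇒ E) (h : (A ⊗X) ⇒ P) →
                           p₁ ∘ h ≈ g ∘ ι₁ → p₂ ∘ h ≈ ι₂ → ev ∘ h ≈ f → g ≈ curry f) where

    isExponential-fromCurry : IsExponential C X B E P p₁ p₂ ev
    isExponential-fromCurry = isP , universal
      where
      universal : ∀ {A Q} (q₁ : Q ⇒ A) (q₂ : Q ⇒ X) → IsProduct C A X Q q₁ q₂ → ∀ (f : Q ⇒ B) →
                  Σ (A ⇒ E) λ g →
                    (∀ (h : Q ⇒ P) → p₁ ∘ h ≈ g ∘ q₁ → p₂ ∘ h ≈ q₂ → ev ∘ h ≈ f) ×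
                    (∀ (g′ : A ⇒ E) → (∀ (h : Q ⇒ P) → p₁ ∘ h ≈ g′ ∘ q₁ → p₂ ∘ h ≈ q₂ → ev ∘ h ≈ f) → g′ ≈ g)
      universal {A} {Q} q₁ q₂ isQ f = curry (f ∘ k) , factors , unique
        where
        module Q = Product isQ
        module I = Product (isι A)
        module P = Product isP
        k : (A ⊗X) ⇒ Q
        k = Q.pair ι₁ ι₂
        k⁻¹ : Q ⇒ (A ⊗X)
        k⁻¹ = I.pair q₁ q₂
        kk⁻¹ : k ∘ k⁻¹ ≈ id
        kk⁻¹ = Q.unique′ (trans≈ (pullˡ Q.project₁) (trans≈ I.project₁ (sym≈ identityʳ)))
                         (trans≈ (pullˡ Q.project₂) (trans≈ I.project₂ (sym≈ identityʳ)))
        k⁻¹k : k⁻¹ ∘ k ≈ id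
        k⁻¹k = I.unique′ (trans≈ (pullˡ I.project₁) (trans≈ Q.project₁ (sym≈ identityʳ)))
                         (trans≈ (pullˡ I.project₂) (trans≈ Q.project₂ (sym≈ identityʳ)))
        through : ∀ {S T D} (u : S ⇒ D) {l : T ⇒ S} {l⁻¹ : S ⇒ T} → l ∘ l⁻¹ ≈ id →
                  u ≈ (u ∘ l) ∘ l⁻¹
        through u ll⁻¹ = trans≈ (sym≈ identityʳ) (trans≈ (∘-resp-≈ʳ (sym≈ ll⁻¹)) sym-assoc)
        factors : ∀ (h : Q ⇒ P) → p₁ ∘ h ≈ curry (f ∘ k) ∘ q₁ → p₂ ∘ h ≈ q₂ → ev ∘ h ≈ f
        factors h e₁ e₂ = begin
          ev ∘ h              ≈⟨ ∘-resp-≈ʳ (through h kk⁻¹) ⟩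
          ev ∘ ((h ∘ k) ∘ k⁻¹) ≈⟨ sym-assoc ⟩
          (ev ∘ (h ∘ k)) ∘ k⁻¹ ≈⟨ ∘-resp-≈ˡ (curry-β (f ∘ k) (h ∘ k)
                                   (trans≈ sym-assoc (trans≈ (∘-resp-≈ˡ e₁) (pullʳ Q.project₁)))
                                   (trans≈ sym-assoc (trans≈ (∘-resp-≈ˡ e₂) Q.project₂))) ⟩
          (f ∘ k) ∘ k⁻¹        ≈⟨ sym≈ (through f kk⁻¹) ⟩
          f                    ∎
        unique : ∀ (g : A ⇒ E) → (∀ (h : Q ⇒ P) → p₁ ∘ h ≈ g ∘ q₁ → p₂ ∘ h ≈ q₂ → ev ∘ h ≈ f) →
                 g ≈ curry (f ∘ k)
        unique g factors-g = curry-unique (f ∘ k) g h P.project₁ P.project₂ (begin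
          ev ∘ h               ≈⟨ ∘-resp-≈ʳ (through h k⁻¹k) ⟩
          ev ∘ ((h ∘ k⁻¹) ∘ k) ≈⟨ sym-assoc ⟩
          (ev ∘ (h ∘ k⁻¹)) ∘ k ≈⟨ ∘-resp-≈ˡ (factors-g (h ∘ k⁻¹)
                                   (trans≈ sym-assoc (trans≈ (∘-resp-≈ˡ P.project₁) (pullʳ I.project₁)))
                                   (trans≈ sym-assoc (trans≈ (∘-resp-≈ˡ P.project₂) I.project₂))) ⟩
          f ∘ k ∎)
          where h = P.pair (g ∘ ι₁) ι₂

lookup-∷ʳ-last : ∀ {a} {A : Set a} {n} (xs : Vec A n) x → V.lookup (xs ∷ʳ x) (fromℕ n) ≡ x
lookup-∷ʳ-last []       x = refl
lookup-∷ʳ-last (y ∷ xs) x = lookup-∷ʳ-last xs x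

lookup-∷ʳ-inject₁ : ∀ {a} {A : Set a} {n} (xs : Vec A n) x i → V.lookup (xs ∷ʳ x) (inject₁ i) ≡ V.lookup xs i
lookup-∷ʳ-inject₁ (y ∷ xs) x zero    = refl
lookup-∷ʳ-inject₁ (y ∷ xs) x (suc i) = lookup-∷ʳ-inject₁ xs x i

lookup-init : ∀ {a} {A : Set a} {n} (vs : Vec A (suc n)) (i : Fin n) →
              V.lookup (V.init vs) i ≡ V.lookup vs (inject₁ i)
lookup-init vs i with V.initLast vs
... | xs , x , refl = sym (lookup-∷ʳ-inject₁ xs x i)

last≡lookup-fromℕ : ∀ {a} {A : Set a} {n} (vs : Vec A (suc n)) → V.last vs ≡ V.lookup vs (fromℕ n)
last≡lookup-fromℕ vs with V.initLast vs
... | xs , x , refl = sym (lookup-∷ʳ-last xs x)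

data LastView : ∀ {n} → Fin (suc n) → Set where
  isLast    : ∀ {n} → LastView (fromℕ n)
  isInject₁ : ∀ {n} (j : Fin n) → LastView (inject₁ j)

lastView : ∀ {n} (i : Fin (suc n)) → LastView i
lastView {zero}  zero    = isLast
lastView {suc n} zero    = isInject₁ zero
lastView {suc n} (suc i) with lastView i
... | isLast      = isLast
... | isInject₁ j = isInject₁ (suc j)

module _ {P : ℕ → Set} where

  All-ext : ∀ {xs} (σ τ : All P xs) → (∀ {x} (p : x ∈ xs) → All.lookup σ p ≡ All.lookup τ p) → σ ≡ τ
  All-ext []      []      h = refl
  All-ext (a ∷ σ) (b ∷ τ) h = cong₂ _∷_ (h (here refl)) (All-ext σ τ (λ p → h (there p)))

  lookup-tabulate : ∀ {xs} (f : ∀ {x} → x ∈ xs → P x) {x} (p : x ∈ xs) → All.lookup (All.tabulate f) p ≡ f p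
  lookup-tabulate f (here refl) = refl
  lookup-tabulate f (there p)   = lookup-tabulate (λ q → f (there q)) p

  lookup-++⁺ˡ : ∀ {A B} (f : All P A) (g : All P B) {x} (p : x ∈ A) →
                All.lookup (++⁺ f g) (∈-++⁺ˡ p) ≡ All.lookup f p
  lookup-++⁺ˡ (a ∷ f) g (here refl) = refl
  lookup-++⁺ˡ (a ∷ f) g (there p)   = lookup-++⁺ˡ f g p

  lookup-++⁺ʳ : ∀ {A B} (f : All P A) (g : All P B) {x} (p : x ∈ B) →
                All.lookup (++⁺ f g) (∈-++⁺ʳ A p) ≡ All.lookup g p
  lookup-++⁺ʳ []      g p = refl
  lookup-++⁺ʳ (a ∷ f) g p = lookup-++⁺ʳ f g p

  ++⁺-ext : ∀ {A B} (h : All P (A ++ B)) (f : All P A) (g : All P B) →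
            (∀ {x} (p : x ∈ A) → All.lookup h (∈-++⁺ˡ p) ≡ All.lookup f p) →
            (∀ {x} (p : x ∈ B) → All.lookup h (∈-++⁺ʳ A p) ≡ All.lookup g p) → h ≡ ++⁺ f g
  ++⁺-ext {[]}    h       []      g e₁ e₂ = All-ext h g e₂
  ++⁺-ext {a ∷ A} (x ∷ h) (y ∷ f) g e₁ e₂ = cong₂ _∷_ (e₁ (here refl)) (++⁺-ext h f g (λ p → e₁ (there p)) e₂)

  lookup-map⁺ : ∀ {B} (f : All (λ b → P (suc b)) B) {b} (p : b ∈ B) →
                All.lookup (map⁺ {P = P} {f = suc} f) (∈-map⁺ suc p) ≡ All.lookup f p
  lookup-map⁺ (x ∷ f) (here refl) = refl
  lookup-map⁺ (x ∷ f) (there p)   = lookup-map⁺ f p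

  map⁺-ext : ∀ {B} (g : All P (L.map suc B)) (f : All (λ b → P (suc b)) B) →
             (∀ {b} (p : b ∈ B) → All.lookup g (∈-map⁺ suc p) ≡ All.lookup f p) → g ≡ map⁺ {P = P} {f = suc} f
  map⁺-ext {[]}    []      []      h = refl
  map⁺-ext {b ∷ B} (x ∷ g) (y ∷ f) h = cong₂ _∷_ (h (here refl)) (map⁺-ext g f (λ p → h (there p)))

-- Substitution

lookup-vsubs : ∀ {Γ m n k} (ts : Vec (Tm Γ m) k) (us : Vec (Tm Γ n) m) i →
               V.lookup (vsubs ts us) i ≡ vsub (V.lookup ts i) us
lookup-vsubs (t ∷ ts) us zero    = refl
lookup-vsubs (t ∷ ts) us (suc i) = lookup-vsubs ts us i

lookup-msubs : ∀ {Γ Δ n k} (σ : MHom Γ Δ) (ts : Vec (Tm Δ n) k) i →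
               V.lookup (msubs σ ts) i ≡ msub σ (V.lookup ts i)
lookup-msubs σ (t ∷ ts) zero    = refl
lookup-msubs σ (t ∷ ts) (suc i) = lookup-msubs σ ts i

vsubs-tabulate : ∀ {Γ m n k} (f : Fin k → Tm Γ m) (us : Vec (Tm Γ n) m) →
                 vsubs (V.tabulate f) us ≡ V.tabulate (λ i → vsub (f i) us)
vsubs-tabulate {k = zero}  f us = refl
vsubs-tabulate {k = suc k} f us = cong (vsub (f zero) us ∷_) (vsubs-tabulate (λ i → f (suc i)) us)

msubs-tabulate : ∀ {Γ Δ n k} (σ : MHom Γ Δ) (f : Fin k → Tm Δ n) →
                 msubs σ (V.tabulate f) ≡ V.tabulate (λ i → msub σ (f i))
msubs-tabulate {k = zero}  σ f = refl
msubs-tabulate {k = suc k} σ f = cong (msub σ (f zero) ∷_) (msubs-tabulate σ (λ i → f (suc i)))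

vsubs-identityˡ : ∀ {Γ m n} (us : Vec (Tm Γ n) m) → vsubs vars us ≡ us
vsubs-identityˡ us = trans (vsubs-tabulate var us) (tabulate∘lookup us)

msubs-vars : ∀ {Γ Δ n} (σ : MHom Γ Δ) → msubs σ (vars {n = n}) ≡ vars
msubs-vars σ = msubs-tabulate σ var

vsubs-∷ʳ : ∀ {Γ m n k} (ts : Vec (Tm Γ m) k) t (us : Vec (Tm Γ n) m) →
           vsubs (ts ∷ʳ t) us ≡ vsubs ts us ∷ʳ vsub t us
vsubs-∷ʳ []       t us = refl
vsubs-∷ʳ (x ∷ ts) t us = cong (vsub x us ∷_) (vsubs-∷ʳ ts t us)

msubs-∷ʳ : ∀ {Γ Δ n k} (σ : MHom Γ Δ) (ts : Vec (Tm Δ n) k) t → msubs σ (ts ∷ʳ t) ≡ msubs σ ts ∷ʳ msub σ t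
msubs-∷ʳ σ []       t = refl
msubs-∷ʳ σ (x ∷ ts) t = cong (msub σ x ∷_) (msubs-∷ʳ σ ts t)

mutual
  vsub-identityʳ : ∀ {Γ n} (t : Tm Γ n) → vsub t vars ≡ t
  vsub-identityʳ (var x)     = lookup∘tabulate var x
  vsub-identityʳ (mvar p ts) = cong (mvar p) (vsubs-identityʳ ts)

  vsubs-identityʳ : ∀ {Γ n k} (ts : Vec (Tm Γ n) k) → vsubs ts vars ≡ ts
  vsubs-identityʳ []       = refl
  vsubs-identityʳ (t ∷ ts) = cong₂ _∷_ (vsub-identityʳ t) (vsubs-identityʳ ts)

mutual
  vsub-assoc : ∀ {Γ m n k} (t : Tm Γ m) (us : Vec (Tm Γ n) m) (vs : Vec (Tm Γ k) n) →
               vsub (vsub t us) vs ≡ vsub t (vsubs us vs)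
  vsub-assoc (var x)     us vs = sym (lookup-vsubs us vs x)
  vsub-assoc (mvar p ts) us vs = cong (mvar p) (vsubs-assoc ts us vs)

  vsubs-assoc : ∀ {Γ m n k j} (ts : Vec (Tm Γ m) j) (us : Vec (Tm Γ n) m) (vs : Vec (Tm Γ k) n) →
                vsubs (vsubs ts us) vs ≡ vsubs ts (vsubs us vs)
  vsubs-assoc []       us vs = refl
  vsubs-assoc (t ∷ ts) us vs = cong₂ _∷_ (vsub-assoc t us vs) (vsubs-assoc ts us vs)

mutual
  msub-vsub : ∀ {Γ Δ m n} (σ : MHom Γ Δ) (t : Tm Δ m) (us : Vec (Tm Δ n) m) →
              msub σ (vsub t us) ≡ vsub (msub σ t) (msubs σ us)
  msub-vsub σ (var x)     us = sym (lookup-msubs σ us x)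
  msub-vsub σ (mvar p ts) us =
    trans (cong (vsub (All.lookup σ p)) (msubs-vsubs σ ts us))
          (sym (vsub-assoc (All.lookup σ p) (msubs σ ts) (msubs σ us)))

  msubs-vsubs : ∀ {Γ Δ m n k} (σ : MHom Γ Δ) (ts : Vec (Tm Δ m) k) (us : Vec (Tm Δ n) m) →
                msubs σ (vsubs ts us) ≡ vsubs (msubs σ ts) (msubs σ us)
  msubs-vsubs σ []       us = refl
  msubs-vsubs σ (t ∷ ts) us = cong₂ _∷_ (msub-vsub σ t us) (msubs-vsubs σ ts us)

mutual
  msub-assoc : ∀ {Γ Δ Θ n} (σ : MHom Γ Δ) (τ : MHom Δ Θ) (t : Tm Θ n) →
               msub σ (msub τ t) ≡ msub (All.map (msub σ) τ) t
  msub-assoc σ τ (var x)     = refl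
  msub-assoc σ τ (mvar p us) =
    trans (msub-vsub σ (All.lookup τ p) (msubs τ us))
          (cong₂ vsub (sym (lookup-amap τ p)) (msubs-assoc σ τ us))

  msubs-assoc : ∀ {Γ Δ Θ n k} (σ : MHom Γ Δ) (τ : MHom Δ Θ) (ts : Vec (Tm Θ n) k) →
                msubs σ (msubs τ ts) ≡ msubs (All.map (msub σ) τ) ts
  msubs-assoc σ τ []       = refl
  msubs-assoc σ τ (t ∷ ts) = cong₂ _∷_ (msub-assoc σ τ t) (msubs-assoc σ τ ts)

msub-mvar-vars : ∀ {Γ Δ m} (σ : MHom Γ Δ) (q : m ∈ Δ) → msub σ (mvar q vars) ≡ All.lookup σ q
msub-mvar-vars σ q = trans (cong (vsub (All.lookup σ q)) (msubs-vars σ)) (vsub-identityʳ _)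

Renaming : List ℕ → List ℕ → Set
Renaming Γ Δ = ∀ {m} → m ∈ Γ → m ∈ Δ

-- Identities and product projections of 𝕄 are of this form.
fromRenaming : ∀ {Γ Δ} → Renaming Γ Δ → MHom Δ Γ
fromRenaming r = All.tabulate (λ p → mvar (r p) vars)

mutual
  rename : ∀ {Γ Δ n} → Renaming Γ Δ → Tm Γ n → Tm Δ n
  rename r (var x)     = var x
  rename r (mvar p us) = mvar (r p) (renames r us)

  renames : ∀ {Γ Δ n k} → Renaming Γ Δ → Vec (Tm Γ n) k → Vec (Tm Δ n) k
  renames r []       = []
  renames r (t ∷ ts) = rename r t ∷ renames r ts

mutual
  msub-renaming : ∀ {Γ Δ n} (r : Renaming Γ Δ) (t : Tm Γ n) → msub (fromRenaming r) t ≡ rename r t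
  msub-renaming r (var x)     = refl
  msub-renaming r (mvar p us) rewrite lookup-tabulate (λ q → mvar (r q) vars) p =
    cong (mvar (r p)) (trans (vsubs-identityˡ _) (msubs-renaming r us))

  msubs-renaming : ∀ {Γ Δ n k} (r : Renaming Γ Δ) (ts : Vec (Tm Γ n) k) → msubs (fromRenaming r) ts ≡ renames r ts
  msubs-renaming r []       = refl
  msubs-renaming r (t ∷ ts) = cong₂ _∷_ (msub-renaming r t) (msubs-renaming r ts)

mutual
  rename-id : ∀ {Γ n} (t : Tm Γ n) → rename (λ p → p) t ≡ t
  rename-id (var x)     = refl
  rename-id (mvar p us) = cong (mvar p) (renames-id us)

  renames-id : ∀ {Γ n k} (ts : Vec (Tm Γ n) k) → renames (λ p → p) ts ≡ ts
  renames-id []       = refl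
  renames-id (t ∷ ts) = cong₂ _∷_ (rename-id t) (renames-id ts)

lookup-∘-renaming : ∀ {Γ Δ Θ} (r : Renaming Γ Δ) (h : MHom Θ Δ) {m} (p : m ∈ Γ) →
                    All.lookup (All.map (msub h) (fromRenaming r)) p ≡ All.lookup h (r p)
lookup-∘-renaming r h p =
  trans (lookup-amap (fromRenaming r) p)
        (trans (cong (msub h) (lookup-tabulate (λ q → mvar (r q) vars) p)) (msub-mvar-vars h (r p)))

-- 𝕄 is cartesian with ⟨0⟩ exponentiable

module 𝕄 = RawCartExp 𝕄raw
module 𝕄C = RawCategory 𝕄cat

𝕄-identityʳ : ∀ {Γ Δ} (f : MHom Γ Δ) → f 𝕄C.∘ 𝕄C.id ≡ f
𝕄-identityʳ []      = refl
𝕄-identityʳ (t ∷ f) = cong₂ _∷_ (trans (msub-renaming (λ p → p) t) (rename-id t)) (𝕄-identityʳ f)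

𝕄-assoc : ∀ {Γ Δ Θ Λ} (f : MHom Γ Δ) (g : MHom Δ Θ) (h : MHom Θ Λ) → (h 𝕄C.∘ g) 𝕄C.∘ f ≡ h 𝕄C.∘ (g 𝕄C.∘ f)
𝕄-assoc f g []      = refl
𝕄-assoc f g (t ∷ h) = cong₂ _∷_ (msub-assoc f g t) (𝕄-assoc f g h)

𝕄-isCategory : IsCategory 𝕄cat
𝕄-isCategory = record
  { equiv     = isEquivalence
  ; ∘-resp-≈  = λ p q → cong₂ 𝕄C._∘_ p q
  ; identityˡ = λ {_} {_} {f} → All-ext _ f (lookup-∘-renaming (λ p → p) f)
  ; identityʳ = λ {_} {_} {f} → 𝕄-identityʳ f
  ; assoc     = λ {_} {_} {_} {_} {f} {g} {h} → 𝕄-assoc f g h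
  }

𝕄-product : ∀ A B → IsProduct 𝕄cat A B (A ++ B) 𝕄.π₁ (𝕄.π₂ {A})
𝕄-product A B f g = ++⁺ f g , project₁ , project₂ , unique
  where
  project₁ : 𝕄.π₁ 𝕄C.∘ ++⁺ f g ≡ f
  project₁ = All-ext _ f λ p → trans (lookup-∘-renaming ∈-++⁺ˡ (++⁺ f g) p) (lookup-++⁺ˡ f g p)
  project₂ : 𝕄.π₂ {A} 𝕄C.∘ ++⁺ f g ≡ g
  project₂ = All-ext _ g λ p → trans (lookup-∘-renaming (∈-++⁺ʳ A) (++⁺ f g) p) (lookup-++⁺ʳ f g p)
  unique : ∀ h → 𝕄.π₁ 𝕄C.∘ h ≡ f → 𝕄.π₂ {A} 𝕄C.∘ h ≡ g → h ≡ ++⁺ f g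
  unique h e₁ e₂ = ++⁺-ext h f g
    (λ p → trans (sym (lookup-∘-renaming ∈-++⁺ˡ h p)) (cong (λ σ → All.lookup σ p) e₁))
    (λ p → trans (sym (lookup-∘-renaming (∈-++⁺ʳ A) h p)) (cong (λ σ → All.lookup σ p) e₂))

𝕄-terminal : IsTerminal 𝕄cat []
𝕄-terminal Z = [] , λ { [] → refl }

⟨0⟩ : List ℕ
⟨0⟩ = 0 ∷ []

data SplitLast (A : List ℕ) : ∀ {m} → m ∈ A ++ ⟨0⟩ → Set where
  old : ∀ {m} (p : m ∈ A) → SplitLast A (∈-++⁺ˡ p)
  new : SplitLast A (∈-++⁺ʳ A (here refl))

splitLast : ∀ A {m} (q : m ∈ A ++ ⟨0⟩) → SplitLast A q
splitLast []      (here refl) = new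
splitLast (a ∷ A) (here refl) = old (here refl)
splitLast (a ∷ A) (there q) with splitLast A q
... | old p = old (there p)
... | new   = new

splitLast-old : ∀ A {m} (p : m ∈ A) → splitLast A (∈-++⁺ˡ p) ≡ old p
splitLast-old (a ∷ A) (here refl) = refl
splitLast-old (a ∷ A) (there p) rewrite splitLast-old A p = refl

splitLast-new : ∀ A → splitLast A (∈-++⁺ʳ A (here refl)) ≡ new
splitLast-new []      = refl
splitLast-new (a ∷ A) rewrite splitLast-new A = refl

-- The bijection Tm (A ++ ⟨0⟩) n ≅ Tm A (suc n) behind the exponential ⟨0⟩ ⇒ A = map suc A:
-- the nullary metavariable new becomes the extra variable x_{n+1}.
mutual
  Λ : ∀ {A n} → Tm (A ++ ⟨0⟩) n → Tm A (suc n)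
  Λ (var i)         = var (inject₁ i)
  Λ {A} (mvar q us) = Λ-mvar (splitLast A q) (Λs us)

  Λ-mvar : ∀ {A n m} {q : m ∈ A ++ ⟨0⟩} → SplitLast A q → Vec (Tm A (suc n)) m → Tm A (suc n)
  Λ-mvar (old p)      us = mvar p us
  Λ-mvar {n = n} new  [] = var (fromℕ n)

  Λs : ∀ {A n k} → Vec (Tm (A ++ ⟨0⟩) n) k → Vec (Tm A (suc n)) k
  Λs []       = []
  Λs (t ∷ ts) = Λ t ∷ Λs ts

newMeta : ∀ {A n} → Tm (A ++ ⟨0⟩) n
newMeta {A} = mvar (∈-++⁺ʳ A (here refl)) []

vars∷ʳnewMeta : ∀ {A n} → Vec (Tm (A ++ ⟨0⟩) n) (suc n)
vars∷ʳnewMeta = vars ∷ʳ newMeta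

Λ⁻¹ : ∀ {A n} → Tm A (suc n) → Tm (A ++ ⟨0⟩) n
Λ⁻¹ s = vsub (rename ∈-++⁺ˡ s) vars∷ʳnewMeta

lookup-vars∷ʳnewMeta : ∀ {A n} (i : Fin n) → V.lookup (vars∷ʳnewMeta {A}) (inject₁ i) ≡ var i
lookup-vars∷ʳnewMeta i = trans (lookup-∷ʳ-inject₁ vars _ i) (lookup∘tabulate var i)

mutual
  Λ⁻¹∘Λ : ∀ {A n} (t : Tm (A ++ ⟨0⟩) n) → Λ⁻¹ (Λ t) ≡ t
  Λ⁻¹∘Λ (var i) = lookup-vars∷ʳnewMeta i
  Λ⁻¹∘Λ {A} (mvar q us) with splitLast A q
  ... | old p = cong (mvar (∈-++⁺ˡ p)) (Λ⁻¹∘Λs us)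
  Λ⁻¹∘Λ {A} (mvar q []) | new = lookup-∷ʳ-last vars newMeta

  Λ⁻¹∘Λs : ∀ {A n k} (ts : Vec (Tm (A ++ ⟨0⟩) n) k) → vsubs (renames ∈-++⁺ˡ (Λs ts)) vars∷ʳnewMeta ≡ ts
  Λ⁻¹∘Λs []       = refl
  Λ⁻¹∘Λs (t ∷ ts) = cong₂ _∷_ (Λ⁻¹∘Λ t) (Λ⁻¹∘Λs ts)

Λ-old : ∀ {A n m} (p : m ∈ A) (us : Vec (Tm (A ++ ⟨0⟩) n) m) → Λ (mvar (∈-++⁺ˡ p) us) ≡ mvar p (Λs us)
Λ-old {A} p us rewrite splitLast-old A p = refl

Λ-newMeta : ∀ {A n} → Λ (newMeta {A} {n}) ≡ var (fromℕ n)
Λ-newMeta {A} rewrite splitLast-new A = refl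

mutual
  Λ∘Λ⁻¹ : ∀ {A n} (s : Tm A (suc n)) → Λ (Λ⁻¹ s) ≡ s
  Λ∘Λ⁻¹ (var i) with lastView i
  ... | isLast      = trans (cong Λ (lookup-∷ʳ-last vars newMeta)) Λ-newMeta
  ... | isInject₁ j = cong Λ (lookup-vars∷ʳnewMeta j)
  Λ∘Λ⁻¹ (mvar q us) = trans (Λ-old q _) (cong (mvar q) (Λ∘Λ⁻¹s us))

  Λ∘Λ⁻¹s : ∀ {A n k} (ts : Vec (Tm A (suc n)) k) → Λs (vsubs (renames ∈-++⁺ˡ ts) vars∷ʳnewMeta) ≡ ts
  Λ∘Λ⁻¹s []       = refl
  Λ∘Λ⁻¹s (t ∷ ts) = cong₂ _∷_ (Λ∘Λ⁻¹ t) (Λ∘Λ⁻¹s ts)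

𝕄-curry : ∀ {A B} → MHom (A ++ ⟨0⟩) B → MHom A (L.map suc B)
𝕄-curry {A} f = map⁺ {P = Tm A} {f = suc} (All.map Λ f)

lookup-𝕄-curry : ∀ {A B} (f : MHom (A ++ ⟨0⟩) B) {b} (p : b ∈ B) →
                 All.lookup (𝕄-curry f) (∈-map⁺ suc p) ≡ Λ (All.lookup f p)
lookup-𝕄-curry {A} f p = trans (lookup-map⁺ {P = Tm A} (All.map Λ f) p) (lookup-amap f p)

lookup-eval∘×id : ∀ {A B} (g : MHom A (L.map suc B)) {b} (p : b ∈ B) →
                  All.lookup (𝕄.eval {B} 𝕄C.∘ ++⁺ (g 𝕄C.∘ 𝕄.π₁ {A} {⟨0⟩}) (𝕄.π₂ {A})) p
                    ≡ Λ⁻¹ (All.lookup g (∈-map⁺ suc p))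
lookup-eval∘×id {A} {B} g p =
  trans (lookup-amap 𝕄.eval p)
    (trans (cong (msub h) (lookup-tabulate (λ q → mvar (∈-++⁺ˡ (∈-map⁺ suc q)) (vars ∷ʳ newMeta)) p))
      (cong₂ vsub lookup-g (trans (msubs-∷ʳ h vars _) (cong₂ _∷ʳ_ (msubs-vars h) lookup-new))))
  where
  g×id = g 𝕄C.∘ 𝕄.π₁ {A} {⟨0⟩}
  h = ++⁺ g×id (𝕄.π₂ {A})
  lookup-g : All.lookup h (∈-++⁺ˡ (∈-map⁺ suc p)) ≡ rename ∈-++⁺ˡ (All.lookup g (∈-map⁺ suc p))
  lookup-g = trans (lookup-++⁺ˡ g×id (𝕄.π₂ {A}) (∈-map⁺ suc p))
               (trans (lookup-amap g (∈-map⁺ suc p)) (msub-renaming ∈-++⁺ˡ (All.lookup g (∈-map⁺ suc p))))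
  lookup-new : msub h (newMeta {L.map suc B}) ≡ newMeta
  lookup-new = cong (λ z → vsub z []) (trans (lookup-++⁺ʳ g×id (𝕄.π₂ {A}) (here refl))
                                             (lookup-tabulate (λ q → mvar (∈-++⁺ʳ A q) vars) (here refl)))

𝕄-exponential : ∀ B → IsExponential 𝕄cat ⟨0⟩ B (L.map suc B) (L.map suc B ++ ⟨0⟩) 𝕄.π₁ (𝕄.π₂ {L.map suc B}) 𝕄.eval
𝕄-exponential B =
  isExponential-fromCurry (𝕄-product (L.map suc B) ⟨0⟩) (_++ ⟨0⟩) 𝕄.π₁ (λ {A} → 𝕄.π₂ {A})
    (λ A → 𝕄-product A ⟨0⟩) 𝕄-curry curry-β curry-unique
  where
  open CategoryProperties 𝕄cat 𝕄-isCategory using (isExponential-fromCurry)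
  module P = CategoryProperties.Product 𝕄cat 𝕄-isCategory (𝕄-product (L.map suc B) ⟨0⟩)
  curry-β : ∀ {A} (f : MHom (A ++ ⟨0⟩) B) h → 𝕄.π₁ 𝕄C.∘ h ≡ 𝕄-curry f 𝕄C.∘ 𝕄.π₁ → 𝕄.π₂ 𝕄C.∘ h ≡ 𝕄.π₂ {A} →
            𝕄.eval 𝕄C.∘ h ≡ f
  curry-β {A} f h e₁ e₂ rewrite P.unique h e₁ e₂ =
    All-ext _ f λ p → trans (lookup-eval∘×id (𝕄-curry f) p) (trans (cong Λ⁻¹ (lookup-𝕄-curry f p)) (Λ⁻¹∘Λ _))
  curry-unique : ∀ {A} (f : MHom (A ++ ⟨0⟩) B) g h → 𝕄.π₁ 𝕄C.∘ h ≡ g 𝕄C.∘ 𝕄.π₁ → 𝕄.π₂ 𝕄C.∘ h ≡ 𝕄.π₂ {A} →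
                 𝕄.eval 𝕄C.∘ h ≡ f → g ≡ 𝕄-curry f
  curry-unique {A} f g h e₁ e₂ e₃ rewrite P.unique h e₁ e₂ =
    map⁺-ext g (All.map Λ f) λ p →
      trans (sym (Λ∘Λ⁻¹ _))
        (trans (cong Λ (trans (sym (lookup-eval∘×id g p)) (cong (λ σ → All.lookup σ p) e₃)))
          (sym (lookup-amap f p)))

𝕄-laws : IsCartExp 𝕄raw
𝕄-laws = record
  { isCategory  = 𝕄-isCategory
  ; terminal    = 𝕄-terminal
  ; product     = 𝕄-product
  ; exponential = 𝕄-exponential
  }

𝕄CE : CartExp 0ℓ 0ℓ 0ℓ
𝕄CE = record { raw = 𝕄raw ; laws = 𝕄-laws }

-- Models of second-order terms

module TermModels {o ℓ e} (C : RawCategory o ℓ e) (isC : IsCategory C) where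
  open CategoryProperties C isC

  record Model : Set (o ⊔ ℓ ⊔ e) where
    field
      Ctx      : List ℕ → Obj
      Ar       : ℕ → Obj
      proj     : ∀ {Γ m} → m ∈ Γ → Ctx Γ ⇒ Ar m
      app      : ∀ {W m} → W ⇒ Ar (suc m) → W ⇒ Ar 0 → W ⇒ Ar m
      app-cong : ∀ {W m} {f f′ : W ⇒ Ar (suc m)} {u u′ : W ⇒ Ar 0} → f ≈ f′ → u ≈ u′ → app f u ≈ app f′ u′
      app-∘    : ∀ {V W m} {f : W ⇒ Ar (suc m)} {u : W ⇒ Ar 0} {k : V ⇒ W} → app f u ∘ k ≈ app (f ∘ k) (u ∘ k)

  infix 4 _≈ᵛ_
  _≈ᵛ_ : ∀ {A B n} → Vec (A ⇒ B) n → Vec (A ⇒ B) n → Set e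
  vs ≈ᵛ ws = ∀ i → V.lookup vs i ≈ V.lookup ws i

  ≈ᵛ-init : ∀ {A B n} {vs ws : Vec (A ⇒ B) (suc n)} → vs ≈ᵛ ws → V.init vs ≈ᵛ V.init ws
  ≈ᵛ-init {vs = vs} {ws} h i rewrite lookup-init vs i | lookup-init ws i = h (inject₁ i)

  ≈ᵛ-last : ∀ {A B n} {vs ws : Vec (A ⇒ B) (suc n)} → vs ≈ᵛ ws → V.last vs ≈ V.last ws
  ≈ᵛ-last {n = n} {vs} {ws} h rewrite last≡lookup-fromℕ vs | last≡lookup-fromℕ ws = h (fromℕ n)

  ≈ᵛ-∷ʳ : ∀ {A B n} {xs ys : Vec (A ⇒ B) n} {x y} → xs ≈ᵛ ys → x ≈ y → xs ∷ʳ x ≈ᵛ ys ∷ʳ y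
  ≈ᵛ-∷ʳ {xs = xs} {ys} {x} {y} h e i with lastView i
  ... | isLast      rewrite lookup-∷ʳ-last xs x | lookup-∷ʳ-last ys y = e
  ... | isInject₁ j rewrite lookup-∷ʳ-inject₁ xs x j | lookup-∷ʳ-inject₁ ys y j = h j

  init∷ʳlast : ∀ {A B n} (vs : Vec (A ⇒ B) (suc n)) → V.init vs ∷ʳ V.last vs ≈ᵛ vs
  init∷ʳlast vs i with lastView i
  ... | isLast      rewrite lookup-∷ʳ-last (V.init vs) (V.last vs) = ≡⇒≈ (last≡lookup-fromℕ vs)
  ... | isInject₁ j rewrite lookup-∷ʳ-inject₁ (V.init vs) (V.last vs) j = ≡⇒≈ (lookup-init vs j)

  map-init : ∀ {a} {A : Set a} {B D n} (F : A → B ⇒ D) (vs : Vec A (suc n)) →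
             V.map F (V.init vs) ≈ᵛ V.init (V.map F vs)
  map-init F vs i = ≡⇒≈ (trans (lookup-map i F (V.init vs))
                      (trans (cong F (lookup-init vs i))
                        (sym (trans (lookup-init (V.map F vs) i) (lookup-map (inject₁ i) F vs)))))

  map-last : ∀ {a} {A : Set a} {B D n} (F : A → B ⇒ D) (vs : Vec A (suc n)) → F (V.last vs) ≈ V.last (V.map F vs)
  map-last {n = n} F vs
    rewrite last≡lookup-fromℕ vs | last≡lookup-fromℕ (V.map F vs) | lookup-map (fromℕ n) F vs = refl≈

  module Semantics (M : Model) where
    open Model M public

    -- Arguments are consumed from the right: the last one fills the outermost exponent.
    apps : ∀ {W m} → W ⇒ Ar m → Vec (W ⇒ Ar 0) m → W ⇒ Ar 0
    apps {m = zero}  f vs = f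
    apps {m = suc m} f vs = apps (app f (V.last vs)) (V.init vs)

    apps-∷ʳ : ∀ {W n} (f : W ⇒ Ar (suc n)) (xs : Vec (W ⇒ Ar 0) n) x → apps f (xs ∷ʳ x) ≡ apps (app f x) xs
    apps-∷ʳ f xs x rewrite init-∷ʳ x xs | last-∷ʳ x xs = refl

    apps-cong : ∀ {W m} {f f′ : W ⇒ Ar m} {vs ws} → f ≈ f′ → vs ≈ᵛ ws → apps f vs ≈ apps f′ ws
    apps-cong {m = zero}  e h = e
    apps-cong {m = suc m} e h = apps-cong (app-cong e (≈ᵛ-last h)) (≈ᵛ-init h)

    apps-∘ : ∀ {V W m} (f : W ⇒ Ar m) (vs : Vec (W ⇒ Ar 0) m) (k : V ⇒ W) →
             apps f vs ∘ k ≈ apps (f ∘ k) (V.map (_∘ k) vs)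
    apps-∘ {m = zero}  f vs k = refl≈
    apps-∘ {m = suc m} f vs k =
      trans≈ (apps-∘ (app f (V.last vs)) (V.init vs) k)
             (apps-cong (trans≈ app-∘ (app-cong refl≈ (map-last (_∘ k) vs))) (map-init (_∘ k) vs))

    mutual
      sem : ∀ {Γ n W} → Tm Γ n → W ⇒ Ctx Γ → Vec (W ⇒ Ar 0) n → W ⇒ Ar 0
      sem (var i)     γ ρ = V.lookup ρ i
      sem (mvar p us) γ ρ = apps (proj p ∘ γ) (sems us γ ρ)

      sems : ∀ {Γ n k W} → Vec (Tm Γ n) k → W ⇒ Ctx Γ → Vec (W ⇒ Ar 0) n → Vec (W ⇒ Ar 0) k
      sems []       γ ρ = []
      sems (t ∷ ts) γ ρ = sem t γ ρ ∷ sems ts γ ρ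

    lookup-sems : ∀ {Γ n k W} (ts : Vec (Tm Γ n) k) (γ : W ⇒ Ctx Γ) ρ i →
                  V.lookup (sems ts γ ρ) i ≡ sem (V.lookup ts i) γ ρ
    lookup-sems (t ∷ ts) γ ρ zero    = refl
    lookup-sems (t ∷ ts) γ ρ (suc i) = lookup-sems ts γ ρ i

    sems-vars : ∀ {Γ n W} (γ : W ⇒ Ctx Γ) (ρ : Vec (W ⇒ Ar 0) n) → sems (vars {Γ}) γ ρ ≈ᵛ ρ
    sems-vars {Γ} γ ρ i =
      ≡⇒≈ (trans (lookup-sems (vars {Γ}) γ ρ i) (cong (λ t → sem t γ ρ) (lookup∘tabulate var i)))

    sems-∷ʳ : ∀ {Γ n k W} (ts : Vec (Tm Γ n) k) t (γ : W ⇒ Ctx Γ) ρ → sems (ts ∷ʳ t) γ ρ ≡ sems ts γ ρ ∷ʳ sem t γ ρ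
    sems-∷ʳ []       t γ ρ = refl
    sems-∷ʳ (x ∷ ts) t γ ρ = cong (sem x γ ρ ∷_) (sems-∷ʳ ts t γ ρ)

    mutual
      sem-cong : ∀ {Γ n W} (t : Tm Γ n) {γ γ′ : W ⇒ Ctx Γ} {ρ ρ′} → γ ≈ γ′ → ρ ≈ᵛ ρ′ → sem t γ ρ ≈ sem t γ′ ρ′
      sem-cong (var i)     e h = h i
      sem-cong (mvar p us) e h = apps-cong (∘-resp-≈ʳ e) (sems-cong us e h)

      sems-cong : ∀ {Γ n k W} (ts : Vec (Tm Γ n) k) {γ γ′ : W ⇒ Ctx Γ} {ρ ρ′} → γ ≈ γ′ → ρ ≈ᵛ ρ′ →
                  sems ts γ ρ ≈ᵛ sems ts γ′ ρ′
      sems-cong (t ∷ ts) e h zero    = sem-cong t e h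
      sems-cong (t ∷ ts) e h (suc i) = sems-cong ts e h i

    mutual
      sem-∘ : ∀ {Γ n V W} (t : Tm Γ n) (γ : W ⇒ Ctx Γ) ρ (k : V ⇒ W) →
              sem t γ ρ ∘ k ≈ sem t (γ ∘ k) (V.map (_∘ k) ρ)
      sem-∘ (var i)     γ ρ k = ≡⇒≈ (sym (lookup-map i (_∘ k) ρ))
      sem-∘ (mvar p us) γ ρ k = trans≈ (apps-∘ (proj p ∘ γ) (sems us γ ρ) k) (apps-cong assoc (sems-∘ us γ ρ k))

      sems-∘ : ∀ {Γ n j V W} (ts : Vec (Tm Γ n) j) (γ : W ⇒ Ctx Γ) ρ (k : V ⇒ W) →
               V.map (_∘ k) (sems ts γ ρ) ≈ᵛ sems ts (γ ∘ k) (V.map (_∘ k) ρ)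
      sems-∘ (t ∷ ts) γ ρ k zero    = sem-∘ t γ ρ k
      sems-∘ (t ∷ ts) γ ρ k (suc i) = sems-∘ ts γ ρ k i

    mutual
      sem-vsub : ∀ {Γ m n W} (s : Tm Γ m) (us : Vec (Tm Γ n) m) (γ : W ⇒ Ctx Γ) ρ →
                 sem (vsub s us) γ ρ ≈ sem s γ (sems us γ ρ)
      sem-vsub (var x)     us γ ρ = ≡⇒≈ (sym (lookup-sems us γ ρ x))
      sem-vsub (mvar p ts) us γ ρ = apps-cong refl≈ (sems-vsub ts us γ ρ)

      sems-vsub : ∀ {Γ m n k W} (ts : Vec (Tm Γ m) k) (us : Vec (Tm Γ n) m) (γ : W ⇒ Ctx Γ) ρ →
                  sems (vsubs ts us) γ ρ ≈ᵛ sems ts γ (sems us γ ρ)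
      sems-vsub (t ∷ ts) us γ ρ zero    = sem-vsub t us γ ρ
      sems-vsub (t ∷ ts) us γ ρ (suc i) = sems-vsub ts us γ ρ i

    module Extensionality
      (_⊗X : Obj → Obj) (ι₁ : ∀ {A} → (A ⊗X) ⇒ A) (ι₂ : ∀ {A} → (A ⊗X) ⇒ Ar 0)
      (isι : ∀ A → IsProduct C A (Ar 0) (A ⊗X) ι₁ ι₂)
      (Ev : ℕ → Obj) (e₁ : ∀ {m} → Ev m ⇒ Ar (suc m)) (e₂ : ∀ {m} → Ev m ⇒ Ar 0) (ev : ∀ {m} → Ev m ⇒ Ar m)
      (exponential : ∀ m → IsExponential C (Ar 0) (Ar m) (Ar (suc m)) (Ev m) e₁ e₂ ev)
      (app≈ev : ∀ {W m} (f : W ⇒ Ar (suc m)) u → app f u ≈ ev ∘ Product.pair (proj₁ (exponential m)) f u) where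

      apps-ext : ∀ n {W} (f g : W ⇒ Ar n) → (∀ {V} (k : V ⇒ W) ρ → apps (f ∘ k) ρ ≈ apps (g ∘ k) ρ) → f ≈ g
      apps-ext zero    f g H = trans≈ (sym≈ identityʳ) (trans≈ (H id []) identityʳ)
      apps-ext (suc n) {W} f g H = trans≈ (curried-unique f refl≈) (sym≈ (curried-unique g uncurry-g≈uncurry-f))
        where
        module E = Product (proj₁ (exponential n))
        uncurry : W ⇒ Ar (suc n) → (W ⊗X) ⇒ Ar n
        uncurry x = app (x ∘ ι₁) ι₂
        open Exponential (exponential n)
        curried-unique : ∀ x → uncurry x ≈ uncurry f → x ≈ transpose (isι W) (uncurry f)
        curried-unique x e = transpose-unique (isι W) (uncurry f) x λ h e₁h e₂h →
          trans≈ (∘-resp-≈ʳ (E.unique h e₁h e₂h)) (trans≈ (sym≈ (app≈ev _ _)) e)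
        apps-uncurry : ∀ x {V} (k : V ⇒ (W ⊗X)) ρ → apps (uncurry x ∘ k) ρ ≈ apps (x ∘ (ι₁ ∘ k)) (ρ ∷ʳ (ι₂ ∘ k))
        apps-uncurry x k ρ = trans≈ (apps-cong {m = n} (trans≈ app-∘ (app-cong assoc refl≈)) (λ i → refl≈))
                                    (≡⇒≈ (sym (apps-∷ʳ _ ρ _)))
        uncurry-g≈uncurry-f : uncurry g ≈ uncurry f
        uncurry-g≈uncurry-f = apps-ext n _ _ λ k ρ →
          trans≈ (apps-uncurry g k ρ) (trans≈ (sym≈ (H (ι₁ ∘ k) (ρ ∷ʳ (ι₂ ∘ k)))) (sym≈ (apps-uncurry f k ρ)))

module ModelMorphism {o ℓ e o′ ℓ′ e′} (C : RawCategory o ℓ e) (isC : IsCategory C)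
                     (D : RawCategory o′ ℓ′ e′) (isD : IsCategory D)
                     (M₁ : TermModels.Model C isC) (M₂ : TermModels.Model D isD) where
  private
    module C = CategoryProperties C isC
    module D = CategoryProperties D isD
    module M₁ = TermModels.Semantics C isC M₁
    module M₂ = TermModels.Semantics D isD M₂
  open TermModels D isD using (_≈ᵛ_; map-init; map-last)

  module _ {W : C.Obj} {W′ : D.Obj}
           (mapCtx : ∀ {Γ} → W C.⇒ M₁.Ctx Γ → W′ D.⇒ M₂.Ctx Γ)
           (mapAr : ∀ {m} → W C.⇒ M₁.Ar m → W′ D.⇒ M₂.Ar m)
           (mapAr-proj : ∀ {Γ m} (p : m ∈ Γ) (γ : W C.⇒ M₁.Ctx Γ) →
                         mapAr (M₁.proj p C.∘ γ) D.≈ M₂.proj p D.∘ mapCtx γ)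
           (mapAr-app : ∀ {m} (f : W C.⇒ M₁.Ar (suc m)) (u : W C.⇒ M₁.Ar 0) →
                        mapAr (M₁.app f u) D.≈ M₂.app (mapAr f) (mapAr u)) where

    mapAr-apps : ∀ {m} (f : W C.⇒ M₁.Ar m) vs → mapAr (M₁.apps f vs) D.≈ M₂.apps (mapAr f) (V.map mapAr vs)
    mapAr-apps {zero}  f vs = D.refl≈
    mapAr-apps {suc m} f vs =
      D.trans≈ (mapAr-apps (M₁.app f (V.last vs)) (V.init vs))
        (M₂.apps-cong (D.trans≈ (mapAr-app f (V.last vs)) (M₂.app-cong D.refl≈ (map-last mapAr vs)))
                      (map-init mapAr vs))

    mutual
      mapAr-sem : ∀ {Γ n} (t : Tm Γ n) (γ : W C.⇒ M₁.Ctx Γ) ρ →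
                  mapAr (M₁.sem t γ ρ) D.≈ M₂.sem t (mapCtx γ) (V.map mapAr ρ)
      mapAr-sem (var i)     γ ρ = D.≡⇒≈ (sym (lookup-map i mapAr ρ))
      mapAr-sem (mvar p us) γ ρ =
        D.trans≈ (mapAr-apps (M₁.proj p C.∘ γ) (M₁.sems us γ ρ))
                 (M₂.apps-cong (mapAr-proj p γ) (mapAr-sems us γ ρ))

      mapAr-sems : ∀ {Γ n k} (ts : Vec (Tm Γ n) k) (γ : W C.⇒ M₁.Ctx Γ) ρ →
                   V.map mapAr (M₁.sems ts γ ρ) ≈ᵛ M₂.sems ts (mapCtx γ) (V.map mapAr ρ)
      mapAr-sems (t ∷ ts) γ ρ zero    = mapAr-sem t γ ρ
      mapAr-sems (t ∷ ts) γ ρ (suc i) = mapAr-sems ts γ ρ i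

-- Uniqueness of 2-cells

sing : ∀ {W m} → Tm W m → MHom W (m ∷ [])
sing t = t ∷ []

++⁺-∘ : ∀ {Γ Δ A B} (k : MHom Γ Δ) (f : MHom Δ A) (g : MHom Δ B) → ++⁺ f g 𝕄C.∘ k ≡ ++⁺ (f 𝕄C.∘ k) (g 𝕄C.∘ k)
++⁺-∘ k []      g = refl
++⁺-∘ k (x ∷ f) g = cong (msub k x ∷_) (++⁺-∘ k f g)

𝕄-model : TermModels.Model 𝕄cat 𝕄-isCategory
𝕄-model = record
  { Ctx      = λ Γ → Γ
  ; Ar       = λ m → m ∷ []
  ; proj     = λ p → sing (mvar p vars)
  ; app      = λ f u → 𝕄.eval 𝕄C.∘ ++⁺ f u
  ; app-cong = λ p q → cong₂ (λ f u → 𝕄.eval 𝕄C.∘ ++⁺ f u) p q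
  ; app-∘    = λ {_} {_} {_} {f} {u} {k} → trans (𝕄-assoc k (++⁺ f u) 𝕄.eval) (cong (𝕄.eval 𝕄C.∘_) (++⁺-∘ k f u))
  }

module 𝕄-model = TermModels.Semantics 𝕄cat 𝕄-isCategory 𝕄-model

app-sing : ∀ {W m} (s : Tm W (suc m)) (v : Tm W 0) →
           𝕄-model.app (sing s) (sing v) ≡ sing (vsub s (vars ∷ʳ vsub v []))
app-sing s v = cong sing (cong (vsub s) (trans (msubs-∷ʳ σ vars _) (cong (_∷ʳ vsub v []) (msubs-vars σ))))
  where σ = s ∷ v ∷ []

apps-sing : ∀ {W m} (s : Tm W m) (vs : Vec (Tm W 0) m) → 𝕄-model.apps (sing s) (V.map sing vs) ≡ sing (vsub s vs)
apps-sing {m = zero}  s [] = cong sing (sym (vsub-identityʳ s))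
apps-sing {m = suc m} s vs with V.initLast vs
... | xs , x , refl
  rewrite map-∷ʳ sing x xs | init-∷ʳ (sing x) (V.map sing xs) | last-∷ʳ (sing x) (V.map sing xs) =
  trans (cong (λ f → 𝕄-model.apps f (V.map sing xs)) (app-sing s x))
    (trans (apps-sing _ xs)
      (cong sing (trans (vsub-assoc s _ xs)
        (cong (vsub s) (trans (vsubs-∷ʳ vars (vsub x []) xs)
          (cong₂ _∷ʳ_ (vsubs-identityˡ xs) (trans (vsub-assoc x [] xs) (vsub-identityʳ x))))))))

mutual
  𝕄-sem : ∀ {Γ n W} (t : Tm Γ n) (γ : MHom W Γ) (vs : Vec (Tm W 0) n) →
          𝕄-model.sem t γ (V.map sing vs) ≡ sing (vsub (msub γ t) vs)
  𝕄-sem (var i)     γ vs = lookup-map i sing vs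
  𝕄-sem (mvar p us) γ vs =
    trans (cong₂ 𝕄-model.apps (cong sing (msub-mvar-vars γ p)) (𝕄-sems us γ vs))
      (trans (apps-sing (All.lookup γ p) (vsubs (msubs γ us) vs))
        (cong sing (sym (vsub-assoc (All.lookup γ p) (msubs γ us) vs))))

  𝕄-sems : ∀ {Γ n k W} (ts : Vec (Tm Γ n) k) (γ : MHom W Γ) (vs : Vec (Tm W 0) n) →
           𝕄-model.sems ts γ (V.map sing vs) ≡ V.map sing (vsubs (msubs γ ts) vs)
  𝕄-sems []       γ vs = refl
  𝕄-sems (t ∷ ts) γ vs = cong₂ _∷_ (𝕄-sem t γ vs) (𝕄-sems ts γ vs)

unsing : ∀ {W m} → MHom W (m ∷ []) → Tm W m
unsing (t ∷ []) = t

sing∘unsing : ∀ {W n} (ρ : Vec (MHom W ⟨0⟩) n) → ρ ≡ V.map sing (V.map unsing ρ)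
sing∘unsing []             = refl
sing∘unsing ((t ∷ []) ∷ ρ) = cong ((t ∷ []) ∷_) (sing∘unsing ρ)

𝕄-apps≡sem : ∀ {Γ n W} (t : Tm Γ n) (γ : MHom W Γ) (ρ : Vec (MHom W ⟨0⟩) n) →
             𝕄-model.apps (sing t 𝕄C.∘ γ) ρ ≡ 𝕄-model.sem t γ ρ
𝕄-apps≡sem t γ ρ rewrite sing∘unsing ρ = trans (apps-sing (msub γ t) _) (sym (𝕄-sem t γ _))

-- Γ extended by n nullary metavariables, which serve as generic arguments.
extendCtx : List ℕ → ℕ → List ℕ
extendCtx Γ zero    = Γ
extendCtx Γ (suc n) = extendCtx Γ n ++ ⟨0⟩

weaken : ∀ {Γ} n → MHom (extendCtx Γ n) Γ
weaken zero    = 𝕄C.id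
weaken (suc n) = weaken n 𝕄C.∘ 𝕄.π₁

fresh : ∀ {Γ} n → Vec (MHom (extendCtx Γ n) ⟨0⟩) n
fresh zero          = []
fresh {Γ} (suc n)   = V.map (𝕄C._∘ 𝕄.π₁) (fresh n) ∷ʳ 𝕄.π₂ {extendCtx Γ n}

module ImageModel {o ℓ e} (C : CartExp o ℓ e) (F : CartExpFunctor 𝕄CE C) where
  private
    module C = CartExp C
    isC = IsCartExp.isCategory C.laws
  open CategoryProperties C.cat isC public
  open CartExpFunctor F public
  open TermModels C.cat isC using (Model; _≈ᵛ_)

  module F× {A B} = Product (pres-× A B)

  F-≡ : ∀ {A B} {f g : MHom A B} → f ≡ g → F₁ f ≈ F₁ g
  F-≡ refl = refl≈

  appF : ∀ {W m} → W ⇒ F₀ (suc m ∷ []) → W ⇒ F₀ ⟨0⟩ → W ⇒ F₀ (m ∷ [])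
  appF {m = m} f u = F₁ (𝕄.eval {m ∷ []}) ∘ F×.pair f u

  model : Model
  model = record
    { Ctx      = F₀
    ; Ar       = λ m → F₀ (m ∷ [])
    ; proj     = λ p → F₁ (sing (mvar p vars))
    ; app      = appF
    ; app-cong = λ p q → ∘-resp-≈ʳ (F×.pair-cong p q)
    ; app-∘    = trans≈ assoc (∘-resp-≈ʳ F×.pair-∘)
    }

  module M = TermModels.Semantics C.cat isC model
  open M public using (apps; sem)

  F-app : ∀ {W m} (f : MHom W (suc m ∷ [])) (u : MHom W ⟨0⟩) → F₁ (𝕄-model.app f u) ≈ appF (F₁ f) (F₁ u)
  F-app {m = m} f u = trans≈ F-∘ (∘-resp-≈ʳ (F×.unique (F₁ (++⁺ f u))
    (trans≈ (sym≈ F-∘) (F-≡ (proj₁ (proj₂ (𝕄-product (suc m ∷ []) ⟨0⟩ f u)))))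
    (trans≈ (sym≈ F-∘) (F-≡ (proj₁ (proj₂ (proj₂ (𝕄-product (suc m ∷ []) ⟨0⟩ f u))))))))

  open ModelMorphism 𝕄cat 𝕄-isCategory C.cat isC 𝕄-model model
  F-apps : ∀ {W m} (f : MHom W (m ∷ [])) vs → F₁ (𝕄-model.apps f vs) ≈ apps (F₁ f) (V.map F₁ vs)
  F-apps = mapAr-apps F₁ F₁ (λ _ _ → F-∘) F-app

  F-sem : ∀ {W Γ n} (t : Tm Γ n) (γ : MHom W Γ) ρ → F₁ (𝕄-model.sem t γ ρ) ≈ sem t (F₁ γ) (V.map F₁ ρ)
  F-sem = mapAr-sem F₁ F₁ (λ _ _ → F-∘) F-app

  tuple : ∀ {Γ} n {W} (γ : W ⇒ F₀ Γ) (ρ : Vec (W ⇒ F₀ ⟨0⟩) n) → W ⇒ F₀ (extendCtx Γ n)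
  tuple zero        γ ρ = γ
  tuple {Γ} (suc n) γ ρ = F×.pair {extendCtx Γ n} {⟨0⟩} (tuple n γ (V.init ρ)) (V.last ρ)

  weaken∘tuple : ∀ {Γ} n {W} (γ : W ⇒ F₀ Γ) ρ → F₁ (weaken n) ∘ tuple n γ ρ ≈ γ
  weaken∘tuple zero        γ ρ = trans≈ (∘-resp-≈ˡ F-id) identityˡ
  weaken∘tuple {Γ} (suc n) γ ρ =
    trans≈ (∘-resp-≈ˡ F-∘) (trans≈ (pullʳ (F×.project₁ {extendCtx Γ n} {⟨0⟩})) (weaken∘tuple n γ (V.init ρ)))

  fresh∘tuple : ∀ {Γ} n {W} (γ : W ⇒ F₀ Γ) ρ i → F₁ (V.lookup (fresh {Γ} n) i) ∘ tuple n γ ρ ≈ V.lookup ρ i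
  fresh∘tuple {Γ} (suc n) γ ρ i with lastView i
  ... | isLast      = trans≈ (∘-resp-≈ˡ (F-≡ (lookup-∷ʳ-last (V.map (𝕄C._∘ 𝕄.π₁) (fresh n)) 𝕄.π₂)))
                        (trans≈ (F×.project₂ {extendCtx Γ n} {⟨0⟩}) (≡⇒≈ (last≡lookup-fromℕ ρ)))
  ... | isInject₁ j = trans≈ (∘-resp-≈ˡ (F-≡ (trans (lookup-∷ʳ-inject₁ (V.map (𝕄C._∘ 𝕄.π₁) (fresh n)) 𝕄.π₂ j)
                                                     (lookup-map j (𝕄C._∘ 𝕄.π₁) (fresh n)))))
                        (trans≈ (∘-resp-≈ˡ F-∘) (trans≈ (pullʳ (F×.project₁ {extendCtx Γ n} {⟨0⟩}))
                          (trans≈ (fresh∘tuple n γ (V.init ρ) j) (≡⇒≈ (lookup-init ρ j)))))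

  -- Any γ, ρ factor through the generic environment (weaken n, fresh n) via tuple n γ ρ,
  -- where the equation holds already in 𝕄 (𝕄-apps≡sem) and is carried over by F.
  apps≈sem : ∀ {Γ n W} (t : Tm Γ n) (γ : W ⇒ F₀ Γ) ρ → apps (F₁ (sing t) ∘ γ) ρ ≈ sem t γ ρ
  apps≈sem {Γ} {n} t γ ρ = begin
    apps (F₁ (sing t) ∘ γ) ρ                    ≈⟨ M.apps-cong {m = n} (∘-resp-≈ʳ (sym≈ (weaken∘tuple n γ ρ))) ρ≈ ⟩
    apps (F₁ (sing t) ∘ (γ′ ∘ k)) (V.map (_∘ k) ρ′) ≈⟨ M.apps-cong {m = n} sym-assoc (λ i → refl≈) ⟩
    apps ((F₁ (sing t) ∘ γ′) ∘ k) (V.map (_∘ k) ρ′) ≈⟨ sym≈ (M.apps-∘ {m = n} (F₁ (sing t) ∘ γ′) ρ′ k) ⟩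
    apps (F₁ (sing t) ∘ γ′) ρ′ ∘ k               ≈⟨ ∘-resp-≈ˡ (M.apps-cong {m = n} (sym≈ F-∘) (λ i → refl≈)) ⟩
    apps (F₁ (sing t 𝕄C.∘ weaken n)) ρ′ ∘ k      ≈⟨ ∘-resp-≈ˡ (sym≈ (F-apps (sing t 𝕄C.∘ weaken n) (fresh n))) ⟩
    F₁ (𝕄-model.apps (sing t 𝕄C.∘ weaken n) (fresh n)) ∘ k ≈⟨ ∘-resp-≈ˡ (F-≡ (𝕄-apps≡sem t (weaken n) (fresh n))) ⟩
    F₁ (𝕄-model.sem t (weaken n) (fresh n)) ∘ k ≈⟨ ∘-resp-≈ˡ (F-sem t (weaken n) (fresh n)) ⟩
    sem t γ′ ρ′ ∘ k                              ≈⟨ M.sem-∘ t γ′ ρ′ k ⟩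
    sem t (γ′ ∘ k) (V.map (_∘ k) ρ′)             ≈⟨ M.sem-cong t (weaken∘tuple n γ ρ) (λ i → sym≈ (ρ≈ i)) ⟩
    sem t γ ρ                                    ∎
    where
    k = tuple n γ ρ
    γ′ = F₁ (weaken {Γ} n)
    ρ′ = V.map F₁ (fresh {Γ} n)
    ρ≈ : ρ ≈ᵛ V.map (_∘ k) ρ′
    ρ≈ i = trans≈ (sym≈ (fresh∘tuple n γ ρ i))
                  (≡⇒≈ (sym (trans (lookup-map i (_∘ k) ρ′) (cong (_∘ k) (lookup-map i F₁ (fresh n))))))

  open M.Extensionality (λ A → A C.×ₒ F₀ ⟨0⟩) C.π₁ C.π₂ (λ A → IsCartExp.product C.laws A (F₀ ⟨0⟩))
         (λ m → F₀ (suc m ∷ 0 ∷ [])) (F₁ 𝕄.π₁) (F₁ (𝕄.π₂ {_ ∷ []})) (F₁ 𝕄.eval) (λ m → pres-⇨ (m ∷ []))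
         (λ {_} {m} f u → ∘-resp-≈ʳ (pair-irrelevant (pres-× (suc m ∷ []) ⟨0⟩) (proj₁ (pres-⇨ (m ∷ []))) f u))
    public

module Transformation {o ℓ e} (C : CartExp o ℓ e) (F G : CartExpFunctor 𝕄CE C) where
  private
    module C = CartExp C
    isC = IsCartExp.isCategory C.laws
    module FI = ImageModel C F
    module GI = ImageModel C G
  open CategoryProperties C.cat isC
  open TermModels C.cat isC using (_≈ᵛ_)

  α₀ : FI.F₀ ⟨0⟩ ⇒ GI.F₀ ⟨0⟩
  α₀ = GI.φ⁻¹ ∘ FI.φ

  α₀⁻¹ : GI.F₀ ⟨0⟩ ⇒ FI.F₀ ⟨0⟩
  α₀⁻¹ = FI.φ⁻¹ ∘ GI.φ

  retract-∘ : ∀ {A B D} {f : A ⇒ B} {g : B ⇒ A} {h : B ⇒ D} {k : D ⇒ B} → g ∘ f ≈ id → k ∘ h ≈ id →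
              (g ∘ k) ∘ (h ∘ f) ≈ id
  retract-∘ gf kh = trans≈ assoc (trans≈ (∘-resp-≈ʳ (cancelˡ kh)) gf)

  α₀⁻¹∘α₀ : α₀⁻¹ ∘ α₀ ≈ id
  α₀⁻¹∘α₀ = retract-∘ FI.φ-isoˡ GI.φ-isoʳ

  α₀∘α₀⁻¹ : α₀ ∘ α₀⁻¹ ≈ id
  α₀∘α₀⁻¹ = retract-∘ GI.φ-isoˡ FI.φ-isoʳ

  Fm×G0 : ∀ m → IsProduct C.cat (FI.F₀ (suc m ∷ [])) (GI.F₀ ⟨0⟩) (FI.F₀ (suc m ∷ ⟨0⟩))
                            (FI.F₁ 𝕄.π₁) (α₀ ∘ FI.F₁ (𝕄.π₂ {suc m ∷ []}))
  Fm×G0 m = isProduct-iso₂ α₀ α₀⁻¹ α₀⁻¹∘α₀ α₀∘α₀⁻¹ (FI.pres-× (suc m ∷ []) ⟨0⟩)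

  module G⇨ m = Exponential (GI.pres-⇨ (m ∷ []))

  αAr : ∀ m → FI.F₀ (m ∷ []) ⇒ GI.F₀ (m ∷ [])
  αAr zero    = α₀
  αAr (suc m) = G⇨.transpose m (Fm×G0 m) (αAr m ∘ FI.F₁ 𝕄.eval)

  αAr-eval : ∀ m → G⇨.Factors m (FI.F₁ 𝕄.π₁) (α₀ ∘ FI.F₁ (𝕄.π₂ {suc m ∷ []})) (αAr m ∘ FI.F₁ 𝕄.eval) (αAr (suc m))
  αAr-eval m = G⇨.transpose-factors m (Fm×G0 m) (αAr m ∘ FI.F₁ 𝕄.eval)

  αAr-unique : ∀ m g → G⇨.Factors m (FI.F₁ 𝕄.π₁) (α₀ ∘ FI.F₁ (𝕄.π₂ {suc m ∷ []})) (αAr m ∘ FI.F₁ 𝕄.eval) g →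
               g ≈ αAr (suc m)
  αAr-unique m = G⇨.transpose-unique m (Fm×G0 m) (αAr m ∘ FI.F₁ 𝕄.eval)

  αCtx : ∀ Γ → FI.F₀ Γ ⇒ GI.F₀ Γ
  αCtx []      = proj₁ (GI.pres-⊤ _)
  αCtx (m ∷ Γ) = GI.F×.pair {m ∷ []} {Γ} (αAr m ∘ FI.F₁ 𝕄.π₁) (αCtx Γ ∘ FI.F₁ (𝕄.π₂ {m ∷ []}))

  proj-there : ∀ {a m Δ} (q : m ∈ Δ) →
               sing (mvar q vars) 𝕄C.∘ 𝕄.π₂ {a ∷ []} {Δ} ≡ sing (mvar (there {x = a} q) vars)
  proj-there {a} q = cong sing (trans (msub-mvar-vars (𝕄.π₂ {a ∷ []}) q)
                                      (lookup-tabulate (λ r → mvar (∈-++⁺ʳ (a ∷ []) r) vars) q))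

  αAr∘proj : ∀ {Γ m} (p : m ∈ Γ) → αAr m ∘ FI.F₁ (sing (mvar p vars)) ≈ GI.F₁ (sing (mvar p vars)) ∘ αCtx Γ
  αAr∘proj {m ∷ Δ} (here refl) = sym≈ (GI.F×.project₁ {m ∷ []} {Δ})
  αAr∘proj {a ∷ Δ} {m} (there q) = begin
    αAr m ∘ FI.F₁ (sing (mvar (there q) vars))
      ≈⟨ ∘-resp-≈ʳ (trans≈ (FI.F-≡ (sym (proj-there q))) FI.F-∘) ⟩
    αAr m ∘ (FI.F₁ (sing (mvar q vars)) ∘ FI.F₁ (𝕄.π₂ {a ∷ []}))
      ≈⟨ trans≈ sym-assoc (∘-resp-≈ˡ (αAr∘proj q)) ⟩
    (GI.F₁ (sing (mvar q vars)) ∘ αCtx Δ) ∘ FI.F₁ (𝕄.π₂ {a ∷ []})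
      ≈⟨ trans≈ assoc (∘-resp-≈ʳ (sym≈ (GI.F×.project₂ {a ∷ []} {Δ}))) ⟩
    GI.F₁ (sing (mvar q vars)) ∘ (GI.F₁ (𝕄.π₂ {a ∷ []}) ∘ αCtx (a ∷ Δ))
      ≈⟨ trans≈ sym-assoc (∘-resp-≈ˡ (trans≈ (sym≈ GI.F-∘) (GI.F-≡ (proj-there q)))) ⟩
    GI.F₁ (sing (mvar (there q) vars)) ∘ αCtx (a ∷ Δ) ∎

  αAr∘app : ∀ {W m} (f : W ⇒ FI.F₀ (suc m ∷ [])) (u : W ⇒ FI.F₀ ⟨0⟩) →
            αAr m ∘ FI.appF f u ≈ GI.appF (αAr (suc m) ∘ f) (α₀ ∘ u)
  αAr∘app {m = m} f u = begin
    αAr m ∘ (FI.F₁ 𝕄.eval ∘ F.pair f u)   ≈⟨ sym-assoc ⟩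
    (αAr m ∘ FI.F₁ 𝕄.eval) ∘ F.pair f u   ≈⟨ ∘-resp-≈ˡ (sym≈ (αAr-eval m h G.project₁ G.project₂)) ⟩
    (GI.F₁ 𝕄.eval ∘ h) ∘ F.pair f u
      ≈⟨ pullʳ (trans≈ G.pair-∘ (G.pair-cong (pullʳ F.project₁) (pullʳ F.project₂))) ⟩
    GI.F₁ 𝕄.eval ∘ G.pair (αAr (suc m) ∘ f) (α₀ ∘ u) ∎
    where
    module F = Product (FI.pres-× (suc m ∷ []) ⟨0⟩)
    module G = Product (GI.pres-× (suc m ∷ []) ⟨0⟩)
    h = G.pair (αAr (suc m) ∘ FI.F₁ 𝕄.π₁) (α₀ ∘ FI.F₁ (𝕄.π₂ {suc m ∷ []}))

  open ModelMorphism C.cat isC C.cat isC FI.model GI.model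
  private
    mapAr-proj : ∀ {W Γ m} (p : m ∈ Γ) (γ : W ⇒ FI.F₀ Γ) →
                 αAr m ∘ (FI.F₁ (sing (mvar p vars)) ∘ γ) ≈ GI.F₁ (sing (mvar p vars)) ∘ (αCtx Γ ∘ γ)
    mapAr-proj p γ = trans≈ sym-assoc (trans≈ (∘-resp-≈ˡ (αAr∘proj p)) assoc)

  α₀∘sem : ∀ {W Γ n} (t : Tm Γ n) (γ : W ⇒ FI.F₀ Γ) ρ → α₀ ∘ FI.sem t γ ρ ≈ GI.sem t (αCtx Γ ∘ γ) (V.map (α₀ ∘_) ρ)
  α₀∘sem = mapAr-sem (λ {Γ} γ → αCtx Γ ∘ γ) (λ {m} f → αAr m ∘ f) mapAr-proj αAr∘app

  α₀∘apps : ∀ {W n} (f : W ⇒ FI.F₀ (n ∷ [])) vs → α₀ ∘ FI.apps f vs ≈ GI.apps (αAr n ∘ f) (V.map (α₀ ∘_) vs)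
  α₀∘apps = mapAr-apps (λ {Γ} γ → αCtx Γ ∘ γ) (λ {m} f → αAr m ∘ f) mapAr-proj αAr∘app

  αAr∘sing : ∀ {Γ n} (t : Tm Γ n) → GI.F₁ (sing t) ∘ αCtx Γ ≈ αAr n ∘ FI.F₁ (sing t)
  αAr∘sing {Γ} {n} t = GI.apps-ext n _ _ λ k ρ → begin
    GI.apps ((GI.F₁ (sing t) ∘ αCtx Γ) ∘ k) ρ                  ≈⟨ GI.M.apps-cong {m = n} assoc (λ i → refl≈) ⟩
    GI.apps (GI.F₁ (sing t) ∘ (αCtx Γ ∘ k)) ρ                  ≈⟨ GI.apps≈sem t (αCtx Γ ∘ k) ρ ⟩
    GI.sem t (αCtx Γ ∘ k) ρ                                     ≈⟨ GI.M.sem-cong t refl≈ (ρ≈ ρ) ⟩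
    GI.sem t (αCtx Γ ∘ k) (V.map (α₀ ∘_) (V.map (α₀⁻¹ ∘_) ρ))  ≈⟨ sym≈ (α₀∘sem t k _) ⟩
    α₀ ∘ FI.sem t k (V.map (α₀⁻¹ ∘_) ρ)                         ≈⟨ ∘-resp-≈ʳ (sym≈ (FI.apps≈sem t k _)) ⟩
    α₀ ∘ FI.apps (FI.F₁ (sing t) ∘ k) (V.map (α₀⁻¹ ∘_) ρ)       ≈⟨ α₀∘apps (FI.F₁ (sing t) ∘ k) _ ⟩
    GI.apps (αAr n ∘ (FI.F₁ (sing t) ∘ k)) (V.map (α₀ ∘_) (V.map (α₀⁻¹ ∘_) ρ))
      ≈⟨ GI.M.apps-cong {m = n} sym-assoc (λ i → sym≈ (ρ≈ ρ i)) ⟩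
    GI.apps ((αAr n ∘ FI.F₁ (sing t)) ∘ k) ρ                   ∎
    where
    ρ≈ : ∀ {W m} (ρ : Vec (W ⇒ GI.F₀ ⟨0⟩) m) → ρ ≈ᵛ V.map (α₀ ∘_) (V.map (α₀⁻¹ ∘_) ρ)
    ρ≈ ρ i = sym≈ (trans≈ (≡⇒≈ (trans (lookup-map i (α₀ ∘_) (V.map (α₀⁻¹ ∘_) ρ))
                                       (cong (α₀ ∘_) (lookup-map i (α₀⁻¹ ∘_) ρ))))
                          (cancelˡ α₀∘α₀⁻¹))

  natural : ∀ {Γ Δ} (σ : MHom Γ Δ) → GI.F₁ σ ∘ αCtx Γ ≈ αCtx Δ ∘ FI.F₁ σ
  natural {Γ} {[]}    []      = !-unique₂ GI.pres-⊤ _ _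
  natural {Γ} {m ∷ Δ} (t ∷ σ) = GI.F×.unique′ {m ∷ []} {Δ}
    (componentwise 𝕄.π₁ (sing t) project₁ (αAr∘sing t) (GI.F×.project₁ {m ∷ []} {Δ}))
    (componentwise (𝕄.π₂ {m ∷ []}) σ project₂ (natural σ) (GI.F×.project₂ {m ∷ []} {Δ}))
    where
    project₁ : 𝕄.π₁ {m ∷ []} {Δ} 𝕄C.∘ (t ∷ σ) ≡ sing t
    project₁ = proj₁ (proj₂ (𝕄-product (m ∷ []) Δ (sing t) σ))
    project₂ : 𝕄.π₂ {m ∷ []} {Δ} 𝕄C.∘ (t ∷ σ) ≡ σ
    project₂ = proj₁ (proj₂ (proj₂ (𝕄-product (m ∷ []) Δ (sing t) σ)))
    componentwise : ∀ {B} (π : MHom (m ∷ Δ) B) (τ : MHom Γ B) {αB : FI.F₀ B ⇒ GI.F₀ B} → π 𝕄C.∘ (t ∷ σ) ≡ τ →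
                    GI.F₁ τ ∘ αCtx Γ ≈ αB ∘ FI.F₁ τ → GI.F₁ π ∘ αCtx (m ∷ Δ) ≈ αB ∘ FI.F₁ π →
                    GI.F₁ π ∘ (GI.F₁ (t ∷ σ) ∘ αCtx Γ) ≈ GI.F₁ π ∘ (αCtx (m ∷ Δ) ∘ FI.F₁ (t ∷ σ))
    componentwise π τ {αB} π∘tσ≡τ natτ natπ = begin
      GI.F₁ π ∘ (GI.F₁ (t ∷ σ) ∘ αCtx Γ) ≈⟨ pullˡ (trans≈ (sym≈ GI.F-∘) (GI.F-≡ π∘tσ≡τ)) ⟩
      GI.F₁ τ ∘ αCtx Γ                    ≈⟨ natτ ⟩
      αB ∘ FI.F₁ τ                        ≈⟨ ∘-resp-≈ʳ (trans≈ (FI.F-≡ (sym π∘tσ≡τ)) FI.F-∘) ⟩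
      αB ∘ (FI.F₁ π ∘ FI.F₁ (t ∷ σ))      ≈⟨ trans≈ sym-assoc (∘-resp-≈ˡ (sym≈ natπ)) ⟩
      (GI.F₁ π ∘ αCtx (m ∷ Δ)) ∘ FI.F₁ (t ∷ σ) ≈⟨ assoc ⟩
      GI.F₁ π ∘ (αCtx (m ∷ Δ) ∘ FI.F₁ (t ∷ σ)) ∎

  αCtx⟨0⟩≈α₀ : αCtx ⟨0⟩ ≈ α₀
  αCtx⟨0⟩≈α₀ = begin
    αCtx ⟨0⟩              ≈⟨ sym≈ (trans≈ (∘-resp-≈ˡ GI.F-id) identityˡ) ⟩
    GI.F₁ 𝕄.π₁ ∘ αCtx ⟨0⟩ ≈⟨ GI.F×.project₁ {⟨0⟩} {[]} ⟩
    α₀ ∘ FI.F₁ 𝕄.π₁       ≈⟨ trans≈ (∘-resp-≈ʳ FI.F-id) identityʳ ⟩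
    α₀                    ∎

  transformation : CartExpTransformation 𝕄CE C F G
  transformation = record
    { η       = αCtx
    ; natural = λ σ → sym≈ (natural σ)
    ; pres-X  = trans≈ (∘-resp-≈ʳ αCtx⟨0⟩≈α₀) (cancelˡ GI.φ-isoʳ)
    }

  module _ (β : CartExpTransformation 𝕄CE C F G) where
    private module β = CartExpTransformation β

    unique-Ar : ∀ m → β.η (m ∷ []) ≈ αAr m
    unique-Ar zero    = trans≈ (sym≈ (cancelˡ GI.φ-isoˡ)) (∘-resp-≈ʳ β.pres-X)
    unique-Ar (suc m) = αAr-unique m (β.η (suc m ∷ [])) λ h e₁ e₂ →
      let h≈β = GI.F×.unique′ {suc m ∷ []} {⟨0⟩} (trans≈ e₁ (β.natural 𝕄.π₁))
                  (trans≈ e₂ (trans≈ (∘-resp-≈ˡ (sym≈ (unique-Ar zero))) (β.natural (𝕄.π₂ {suc m ∷ []}))))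
      in trans≈ (∘-resp-≈ʳ h≈β) (trans≈ (sym≈ (β.natural 𝕄.eval)) (∘-resp-≈ˡ (unique-Ar m)))

    unique : ∀ Γ → β.η Γ ≈ αCtx Γ
    unique []      = !-unique₂ GI.pres-⊤ _ _
    unique (m ∷ Γ) = GI.F×.unique′ {m ∷ []} {Γ}
      (trans≈ (sym≈ (β.natural 𝕄.π₁)) (trans≈ (∘-resp-≈ˡ (unique-Ar m)) (sym≈ (GI.F×.project₁ {m ∷ []} {Γ}))))
      (trans≈ (sym≈ (β.natural (𝕄.π₂ {m ∷ []})))
              (trans≈ (∘-resp-≈ˡ (unique Γ)) (sym≈ (GI.F×.project₂ {m ∷ []} {Γ}))))

-- Existence of a structure preserving functor

module Interpretation {o ℓ e} (C : CartExp o ℓ e) where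
  private
    module C = CartExp C
    isC = IsCartExp.isCategory C.laws
  open CategoryProperties C.cat isC
  open TermModels C.cat isC using (Model; _≈ᵛ_; ≈ᵛ-∷ʳ; init∷ʳlast)
  open C using (⊤; X; X⇨_; eval; π₁; π₂)

  infixr 25 _⊗_
  _⊗_ : Obj → Obj → Obj
  _⊗_ = C._×ₒ_

  module P {A B} = Product (IsCartExp.product C.laws A B)

  ⟨_,_⟩ : ∀ {Z A B} → Z ⇒ A → Z ⇒ B → Z ⇒ A ⊗ B
  ⟨ f , g ⟩ = P.pair f g

  ! : ∀ {Z} → Z ⇒ ⊤
  ! = proj₁ (IsCartExp.terminal C.laws _)

  module Exp B = Exponential (IsCartExp.exponential C.laws B)

  curry : ∀ {A B} → A ⊗ X ⇒ B → A ⇒ (X⇨ B)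
  curry {A} {B} f = Exp.transpose B (IsCartExp.product C.laws A X) f

  curry-unique : ∀ {A B} {f : A ⊗ X ⇒ B} g → eval ∘ ⟨ g ∘ π₁ , π₂ ⟩ ≈ f → g ≈ curry f
  curry-unique {A} {B} g e = Exp.transpose-unique B _ _ g λ h e₁ e₂ → trans≈ (∘-resp-≈ʳ (P.unique h e₁ e₂)) e

  curry-cong : ∀ {A B} {f f′ : A ⊗ X ⇒ B} → f ≈ f′ → curry f ≈ curry f′
  curry-cong {A} {B} {f} e =
    curry-unique (curry f) (trans≈ (Exp.transpose-factors B _ f _ P.project₁ P.project₂) e)

  curry-β : ∀ {Z A B} (f : A ⊗ X ⇒ B) (a : Z ⇒ A) (b : Z ⇒ X) → eval ∘ ⟨ curry f ∘ a , b ⟩ ≈ f ∘ ⟨ a , b ⟩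
  curry-β f a b = begin
    eval ∘ ⟨ curry f ∘ a , b ⟩
      ≈⟨ ∘-resp-≈ʳ (sym≈ (P.unique (⟨ curry f ∘ π₁ , π₂ ⟩ ∘ ⟨ a , b ⟩)
                        (trans≈ (pullˡ P.project₁) (pullʳ P.project₁)) (trans≈ (pullˡ P.project₂) P.project₂))) ⟩
    eval ∘ (⟨ curry f ∘ π₁ , π₂ ⟩ ∘ ⟨ a , b ⟩)
      ≈⟨ pullˡ (Exp.transpose-factors _ _ f _ P.project₁ P.project₂) ⟩
    f ∘ ⟨ a , b ⟩ ∎

  E : ℕ → Obj
  E zero    = X
  E (suc m) = X⇨ (E m)

  ⟦_⟧ : List ℕ → Obj
  ⟦ [] ⟧    = ⊤
  ⟦ m ∷ Γ ⟧ = E m ⊗ ⟦ Γ ⟧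

  proj : ∀ {Γ m} → m ∈ Γ → ⟦ Γ ⟧ ⇒ E m
  proj (here refl) = π₁
  proj (there p)   = proj p ∘ π₂

  model : Model
  model = record
    { Ctx      = ⟦_⟧
    ; Ar       = E
    ; proj     = proj
    ; app      = λ f u → eval ∘ ⟨ f , u ⟩
    ; app-cong = λ p q → ∘-resp-≈ʳ (P.pair-cong p q)
    ; app-∘    = trans≈ assoc (∘-resp-≈ʳ P.pair-∘)
    }

  module M = TermModels.Semantics C.cat isC model
  open M using (apps; sem; sems)
  open M.Extensionality (_⊗ X) π₁ π₂ (λ A → IsCartExp.product C.laws A X) (λ m → E (suc m) ⊗ X) π₁ π₂ eval
         (λ m → IsCartExp.exponential C.laws (E m))
         (λ {_} {m} f u → ∘-resp-≈ʳ (pair-irrelevant (IsCartExp.product C.laws (E (suc m)) X)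
                                                   (proj₁ (IsCartExp.exponential C.laws (E m))) f u))

  -- A natural operation W × Xᵐ → X, presented on generalized elements.
  record NaturalOp (W : Obj) (m : ℕ) : Set (o ⊔ ℓ ⊔ e) where
    field
      op      : ∀ {Z} → Z ⇒ W → Vec (Z ⇒ X) m → Z ⇒ X
      op-cong : ∀ {Z} {γ γ′ : Z ⇒ W} {ρ ρ′} → γ ≈ γ′ → ρ ≈ᵛ ρ′ → op γ ρ ≈ op γ′ ρ′
      op-∘    : ∀ {Y Z} (γ : Z ⇒ W) ρ (k : Y ⇒ Z) → op γ ρ ∘ k ≈ op (γ ∘ k) (V.map (_∘ k) ρ)
  open NaturalOp

  uncurryLast : ∀ {W m} → NaturalOp W (suc m) → NaturalOp (W ⊗ X) m
  uncurryLast Φ = record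
    { op      = λ γ ρ → op Φ (π₁ ∘ γ) (ρ ∷ʳ (π₂ ∘ γ))
    ; op-cong = λ {_} {_} {_} {ρ} {ρ′} e h → op-cong Φ (∘-resp-≈ʳ e) (≈ᵛ-∷ʳ {xs = ρ} {ys = ρ′} h (∘-resp-≈ʳ e))
    ; op-∘    = λ γ ρ k → trans≈ (op-∘ Φ _ _ k) (op-cong Φ assoc
                  (λ i → trans≈ (≡⇒≈ (cong (λ z → V.lookup z i) (map-∷ʳ (_∘ k) (π₂ ∘ γ) ρ)))
                                 (≈ᵛ-∷ʳ {xs = V.map (_∘ k) ρ} {ys = V.map (_∘ k) ρ} (λ j → refl≈) assoc i)))
    }

  curryⁿ : ∀ {W} m → NaturalOp W m → W ⇒ E m
  curryⁿ zero    Φ = op Φ id []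
  curryⁿ (suc m) Φ = curry (curryⁿ m (uncurryLast Φ))

  curryⁿ-β : ∀ {W Z} m (Φ : NaturalOp W m) (γ : Z ⇒ W) vs → apps (curryⁿ m Φ ∘ γ) vs ≈ op Φ γ vs
  curryⁿ-β zero    Φ γ [] = trans≈ (op-∘ Φ id [] γ) (op-cong Φ identityˡ (λ ()))
  curryⁿ-β (suc m) Φ γ vs = begin
    apps (eval ∘ ⟨ curry (curryⁿ m (uncurryLast Φ)) ∘ γ , V.last vs ⟩) (V.init vs)
      ≈⟨ M.apps-cong {m = m} (curry-β _ γ (V.last vs)) (λ i → refl≈) ⟩
    apps (curryⁿ m (uncurryLast Φ) ∘ ⟨ γ , V.last vs ⟩) (V.init vs)
      ≈⟨ curryⁿ-β m (uncurryLast Φ) _ (V.init vs) ⟩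
    op Φ (π₁ ∘ ⟨ γ , V.last vs ⟩) (V.init vs ∷ʳ (π₂ ∘ ⟨ γ , V.last vs ⟩))
      ≈⟨ op-cong Φ P.project₁ (λ i → trans≈ (≈ᵛ-∷ʳ {xs = V.init vs} {ys = V.init vs} (λ j → refl≈) P.project₂ i)
                                            (init∷ʳlast vs i)) ⟩
    op Φ γ vs ∎

  termOp : ∀ {Γ n} → Tm Γ n → NaturalOp ⟦ Γ ⟧ n
  termOp t = record { op = sem t ; op-cong = M.sem-cong t ; op-∘ = M.sem-∘ t }

  ⟦_⟧ᵗ : ∀ {Γ n} → Tm Γ n → ⟦ Γ ⟧ ⇒ E n
  ⟦_⟧ᵗ {n = n} t = curryⁿ n (termOp t)

  ⟦⟧ᵗ-β : ∀ {Γ n Z} (t : Tm Γ n) (γ : Z ⇒ ⟦ Γ ⟧) vs → apps (⟦ t ⟧ᵗ ∘ γ) vs ≈ sem t γ vs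
  ⟦⟧ᵗ-β {n = n} t = curryⁿ-β n (termOp t)

  ⟦⟧ᵗ-≡ : ∀ {Γ n} {s t : Tm Γ n} → s ≡ t → ⟦ s ⟧ᵗ ≈ ⟦ t ⟧ᵗ
  ⟦⟧ᵗ-≡ refl = refl≈

  I₁ : ∀ {Γ Δ} → MHom Γ Δ → ⟦ Γ ⟧ ⇒ ⟦ Δ ⟧
  I₁ []      = !
  I₁ (t ∷ σ) = ⟨ ⟦ t ⟧ᵗ , I₁ σ ⟩

  proj∘I₁ : ∀ {Γ Δ m} (σ : MHom Γ Δ) (p : m ∈ Δ) → proj p ∘ I₁ σ ≈ ⟦ All.lookup σ p ⟧ᵗ
  proj∘I₁ (t ∷ σ) (here refl) = P.project₁
  proj∘I₁ (t ∷ σ) (there p)   = trans≈ (pullʳ P.project₂) (proj∘I₁ σ p)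

  proj-ext : ∀ Δ {W} (h h′ : W ⇒ ⟦ Δ ⟧) → (∀ {m} (p : m ∈ Δ) → proj p ∘ h ≈ proj p ∘ h′) → h ≈ h′
  proj-ext []      h h′ H = !-unique₂ (IsCartExp.terminal C.laws) h h′
  proj-ext (m ∷ Δ) h h′ H =
    P.unique′ (H (here refl)) (proj-ext Δ (π₂ ∘ h) (π₂ ∘ h′) (λ p → trans≈ sym-assoc (trans≈ (H (there p)) assoc)))

  mutual
    sem-msub : ∀ {Γ Δ n W} (σ : MHom Γ Δ) (t : Tm Δ n) (γ : W ⇒ ⟦ Γ ⟧) ρ → sem (msub σ t) γ ρ ≈ sem t (I₁ σ ∘ γ) ρ
    sem-msub σ (var i)         γ ρ = refl≈
    sem-msub σ (mvar {m} p us) γ ρ = begin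
      sem (vsub (All.lookup σ p) (msubs σ us)) γ ρ    ≈⟨ M.sem-vsub (All.lookup σ p) (msubs σ us) γ ρ ⟩
      sem (All.lookup σ p) γ (sems (msubs σ us) γ ρ)   ≈⟨ M.sem-cong (All.lookup σ p) refl≈ (sems-msub σ us γ ρ) ⟩
      sem (All.lookup σ p) γ (sems us (I₁ σ ∘ γ) ρ)    ≈⟨ sym≈ (⟦⟧ᵗ-β (All.lookup σ p) γ _) ⟩
      apps (⟦ All.lookup σ p ⟧ᵗ ∘ γ) (sems us (I₁ σ ∘ γ) ρ)
        ≈⟨ M.apps-cong {m = m} (trans≈ (∘-resp-≈ˡ (sym≈ (proj∘I₁ σ p))) assoc) (λ i → refl≈) ⟩
      apps (proj p ∘ (I₁ σ ∘ γ)) (sems us (I₁ σ ∘ γ) ρ) ∎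

    sems-msub : ∀ {Γ Δ n k W} (σ : MHom Γ Δ) (ts : Vec (Tm Δ n) k) (γ : W ⇒ ⟦ Γ ⟧) ρ →
                sems (msubs σ ts) γ ρ ≈ᵛ sems ts (I₁ σ ∘ γ) ρ
    sems-msub σ (t ∷ ts) γ ρ zero    = sem-msub σ t γ ρ
    sems-msub σ (t ∷ ts) γ ρ (suc i) = sems-msub σ ts γ ρ i

  ⟦msub⟧ᵗ : ∀ {Γ Δ m} (σ : MHom Γ Δ) (t : Tm Δ m) → ⟦ msub σ t ⟧ᵗ ≈ ⟦ t ⟧ᵗ ∘ I₁ σ
  ⟦msub⟧ᵗ {m = m} σ t = apps-ext m ⟦ msub σ t ⟧ᵗ (⟦ t ⟧ᵗ ∘ I₁ σ) λ k ρ →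
    trans≈ (⟦⟧ᵗ-β (msub σ t) k ρ)
      (trans≈ (sem-msub σ t k ρ)
        (trans≈ (sym≈ (⟦⟧ᵗ-β t (I₁ σ ∘ k) ρ)) (M.apps-cong {m = m} sym-assoc (λ i → refl≈))))

  I₁-∘ : ∀ {Γ Δ Θ} (σ : MHom Γ Δ) (τ : MHom Δ Θ) → I₁ (τ 𝕄C.∘ σ) ≈ I₁ τ ∘ I₁ σ
  I₁-∘ {Γ} {Θ = Θ} σ τ = proj-ext Θ _ _ λ p → begin
    proj p ∘ I₁ (τ 𝕄C.∘ σ)        ≈⟨ proj∘I₁ (τ 𝕄C.∘ σ) p ⟩
    ⟦ All.lookup (τ 𝕄C.∘ σ) p ⟧ᵗ  ≈⟨ ⟦⟧ᵗ-≡ {Γ} (lookup-amap {f = msub σ} τ p) ⟩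
    ⟦ msub σ (All.lookup τ p) ⟧ᵗ  ≈⟨ ⟦msub⟧ᵗ σ (All.lookup τ p) ⟩
    ⟦ All.lookup τ p ⟧ᵗ ∘ I₁ σ    ≈⟨ ∘-resp-≈ˡ (sym≈ (proj∘I₁ τ p)) ⟩
    (proj p ∘ I₁ τ) ∘ I₁ σ        ≈⟨ assoc ⟩
    proj p ∘ (I₁ τ ∘ I₁ σ)        ∎

  ⟦mvar⟧ᵗ : ∀ {Γ m} (q : m ∈ Γ) → ⟦ mvar q vars ⟧ᵗ ≈ proj q
  ⟦mvar⟧ᵗ {m = m} q = apps-ext m ⟦ mvar q vars ⟧ᵗ (proj q) λ k ρ →
    trans≈ (⟦⟧ᵗ-β (mvar q vars) k ρ) (M.apps-cong {m = m} refl≈ (M.sems-vars k ρ))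

  proj∘I₁-renaming : ∀ {Γ Δ m} (r : Renaming Γ Δ) (p : m ∈ Γ) → proj p ∘ I₁ (fromRenaming r) ≈ proj (r p)
  proj∘I₁-renaming r p =
    trans≈ (proj∘I₁ (fromRenaming r) p)
           (trans≈ (⟦⟧ᵗ-≡ (lookup-tabulate (λ q → mvar (r q) vars) p)) (⟦mvar⟧ᵗ (r p)))

  I₁-id : ∀ {Γ} → I₁ (𝕄C.id {Γ}) ≈ id
  I₁-id {Γ} = proj-ext Γ _ _ λ p → trans≈ (proj∘I₁-renaming (λ q → q) p) (sym≈ identityʳ)

  pair++ : ∀ A {B Z} → Z ⇒ ⟦ A ⟧ → Z ⇒ ⟦ B ⟧ → Z ⇒ ⟦ A ++ B ⟧
  pair++ []      f g = g
  pair++ (a ∷ A) f g = ⟨ π₁ ∘ f , pair++ A (π₂ ∘ f) g ⟩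

  proj∘pair++ˡ : ∀ A {B Z m} (f : Z ⇒ ⟦ A ⟧) (g : Z ⇒ ⟦ B ⟧) (p : m ∈ A) →
                 proj (∈-++⁺ˡ {ys = B} p) ∘ pair++ A f g ≈ proj p ∘ f
  proj∘pair++ˡ (a ∷ A) f g (here refl) = P.project₁
  proj∘pair++ˡ (a ∷ A) f g (there p)   = trans≈ (pullʳ P.project₂) (trans≈ (proj∘pair++ˡ A (π₂ ∘ f) g p) sym-assoc)

  proj∘pair++ʳ : ∀ A {B Z m} (f : Z ⇒ ⟦ A ⟧) (g : Z ⇒ ⟦ B ⟧) (p : m ∈ B) →
                 proj (∈-++⁺ʳ A p) ∘ pair++ A f g ≈ proj p ∘ g
  proj∘pair++ʳ []      f g p = refl≈
  proj∘pair++ʳ (a ∷ A) f g p = trans≈ (pullʳ P.project₂) (proj∘pair++ʳ A (π₂ ∘ f) g p)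

  proj-ext++ : ∀ A {B W} (h h′ : W ⇒ ⟦ A ++ B ⟧) →
               (∀ {m} (p : m ∈ A) → proj (∈-++⁺ˡ {ys = B} p) ∘ h ≈ proj (∈-++⁺ˡ {ys = B} p) ∘ h′) →
               (∀ {m} (p : m ∈ B) → proj (∈-++⁺ʳ A p) ∘ h ≈ proj (∈-++⁺ʳ A p) ∘ h′) → h ≈ h′
  proj-ext++ []      {B} h h′ H₁ H₂ = proj-ext B h h′ H₂
  proj-ext++ (a ∷ A)     h h′ H₁ H₂ = P.unique′ (H₁ (here refl))
    (proj-ext++ A (π₂ ∘ h) (π₂ ∘ h′) (λ p → trans≈ sym-assoc (trans≈ (H₁ (there p)) assoc))
                                     (λ p → trans≈ sym-assoc (trans≈ (H₂ p) assoc)))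

  proj-ext-map⁺ : ∀ B {W} (h h′ : W ⇒ ⟦ L.map suc B ⟧) →
                  (∀ {b} (p : b ∈ B) → proj (∈-map⁺ suc p) ∘ h ≈ proj (∈-map⁺ suc p) ∘ h′) → h ≈ h′
  proj-ext-map⁺ []      h h′ H = !-unique₂ (IsCartExp.terminal C.laws) h h′
  proj-ext-map⁺ (b ∷ B) h h′ H =
    P.unique′ (H (here refl))
              (proj-ext-map⁺ B (π₂ ∘ h) (π₂ ∘ h′) (λ p → trans≈ sym-assoc (trans≈ (H (there p)) assoc)))

  I-product : ∀ A B → IsProduct C.cat ⟦ A ⟧ ⟦ B ⟧ ⟦ A ++ B ⟧ (I₁ (𝕄.π₁ {A} {B})) (I₁ (𝕄.π₂ {A} {B}))
  I-product A B f g = pair++ A f g , project₁ , project₂ , unique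
    where
    project₁ : I₁ (𝕄.π₁ {A} {B}) ∘ pair++ A f g ≈ f
    project₁ = proj-ext A _ _ λ p →
      trans≈ sym-assoc (trans≈ (∘-resp-≈ˡ (proj∘I₁-renaming (∈-++⁺ˡ {ys = B}) p)) (proj∘pair++ˡ A f g p))
    project₂ : I₁ (𝕄.π₂ {A}) ∘ pair++ A f g ≈ g
    project₂ = proj-ext B _ _ λ p →
      trans≈ sym-assoc (trans≈ (∘-resp-≈ˡ (proj∘I₁-renaming (∈-++⁺ʳ A) p)) (proj∘pair++ʳ A f g p))
    unique : ∀ h → I₁ (𝕄.π₁ {A} {B}) ∘ h ≈ f → I₁ (𝕄.π₂ {A}) ∘ h ≈ g → h ≈ pair++ A f g
    unique h e₁ e₂ = proj-ext++ A h (pair++ A f g)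
      (λ p → trans≈ (∘-resp-≈ˡ (sym≈ (proj∘I₁-renaming (∈-++⁺ˡ {ys = B}) p)))
               (trans≈ assoc (trans≈ (∘-resp-≈ʳ e₁) (sym≈ (proj∘pair++ˡ A f g p)))))
      (λ p → trans≈ (∘-resp-≈ˡ (sym≈ (proj∘I₁-renaming (∈-++⁺ʳ A) p)))
               (trans≈ assoc (trans≈ (∘-resp-≈ʳ e₂) (sym≈ (proj∘pair++ʳ A f g p)))))

  φ⁻¹ : X ⇒ ⟦ ⟨0⟩ ⟧
  φ⁻¹ = ⟨ id , ! ⟩

  φ⁻¹∘π₁ : φ⁻¹ ∘ π₁ ≈ id
  φ⁻¹∘π₁ = P.unique′ (trans≈ (pullˡ P.project₁) (trans≈ identityˡ (sym≈ identityʳ)))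
                     (!-unique₂ (IsCartExp.terminal C.laws) _ _)

  id×φ⁻¹ : ∀ {A} → A ⊗ X ⇒ A ⊗ ⟦ ⟨0⟩ ⟧
  id×φ⁻¹ = ⟨ π₁ , φ⁻¹ ∘ π₂ ⟩

  id×φ⁻¹∘id×π₁ : ∀ {A} → id×φ⁻¹ {A} ∘ ⟨ π₁ , π₁ ∘ π₂ ⟩ ≈ id
  id×φ⁻¹∘id×π₁ = P.unique′ (trans≈ (pullˡ P.project₁) (trans≈ P.project₁ (sym≈ identityʳ)))
                           (trans≈ (pullˡ P.project₂) (trans≈ (pullʳ P.project₂)
                             (trans≈ sym-assoc (trans≈ (∘-resp-≈ˡ φ⁻¹∘π₁) (trans≈ identityˡ (sym≈ identityʳ))))))

  curryᴮ : ∀ B {A} → A ⊗ ⟦ ⟨0⟩ ⟧ ⇒ ⟦ B ⟧ → A ⇒ ⟦ L.map suc B ⟧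
  curryᴮ []      f = !
  curryᴮ (b ∷ B) f = ⟨ curry ((π₁ ∘ f) ∘ id×φ⁻¹) , curryᴮ B (π₂ ∘ f) ⟩

  proj∘curryᴮ : ∀ B {A b} (f : A ⊗ ⟦ ⟨0⟩ ⟧ ⇒ ⟦ B ⟧) (p : b ∈ B) →
                proj (∈-map⁺ suc p) ∘ curryᴮ B f ≈ curry ((proj p ∘ f) ∘ id×φ⁻¹)
  proj∘curryᴮ (b ∷ B) f (here refl) = P.project₁
  proj∘curryᴮ (b ∷ B) f (there p)   =
    trans≈ (pullʳ P.project₂) (trans≈ (proj∘curryᴮ B (π₂ ∘ f) p) (curry-cong (∘-resp-≈ˡ sym-assoc)))

  module _ (B : List ℕ) where
    private
      B⁺ : List ℕ
      B⁺ = L.map suc B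

      p₁ : ⟦ B⁺ ++ ⟨0⟩ ⟧ ⇒ ⟦ B⁺ ⟧
      p₁ = I₁ (𝕄.π₁ {B⁺} {⟨0⟩})

      p₂ : ⟦ B⁺ ++ ⟨0⟩ ⟧ ⇒ ⟦ ⟨0⟩ ⟧
      p₂ = I₁ (𝕄.π₂ {B⁺} {⟨0⟩})

      ev : ⟦ B⁺ ++ ⟨0⟩ ⟧ ⇒ ⟦ B ⟧
      ev = I₁ (𝕄.eval {B})

      old∈ : ∀ {b} → b ∈ B → suc b ∈ B⁺ ++ ⟨0⟩
      old∈ p = ∈-++⁺ˡ (∈-map⁺ suc p)

      new∈ : 0 ∈ B⁺ ++ ⟨0⟩
      new∈ = ∈-++⁺ʳ B⁺ (here refl)

    proj∘ev : ∀ {b} (p : b ∈ B) → proj p ∘ ev ≈ eval ∘ ⟨ proj (old∈ p) , proj new∈ ⟩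
    proj∘ev {b} p = trans≈ (proj∘I₁ 𝕄.eval p)
      (trans≈ (⟦⟧ᵗ-≡ (lookup-tabulate (λ q → mvar (old∈ q) (vars ∷ʳ mvar new∈ [])) p))
        (apps-ext b _ _ λ k ρ →
          trans≈ (⟦⟧ᵗ-β (mvar (old∈ p) (vars ∷ʳ mvar new∈ [])) k ρ)
            (trans≈ (M.apps-cong {m = suc b} refl≈ (λ i →
                       trans≈ (≡⇒≈ (cong (λ z → V.lookup z i) (M.sems-∷ʳ (vars {B⁺ ++ ⟨0⟩}) (mvar new∈ []) k ρ)))
                              (≈ᵛ-∷ʳ {xs = sems (vars {B⁺ ++ ⟨0⟩}) k ρ} {ys = ρ} (M.sems-vars k ρ) refl≈ i)))
              (trans≈ (≡⇒≈ (M.apps-∷ʳ (proj (old∈ p) ∘ k) ρ (proj new∈ ∘ k)))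
                      (M.apps-cong {m = b} (sym≈ (trans≈ assoc (∘-resp-≈ʳ P.pair-∘))) (λ i → refl≈))))))

    proj∘ev∘ : ∀ {Z b} (h : Z ⇒ ⟦ B⁺ ++ ⟨0⟩ ⟧) (p : b ∈ B) →
               proj p ∘ (ev ∘ h) ≈ eval ∘ ⟨ proj (∈-map⁺ suc p) ∘ (p₁ ∘ h) , π₁ ∘ (p₂ ∘ h) ⟩
    proj∘ev∘ h p = trans≈ sym-assoc (trans≈ (∘-resp-≈ˡ (proj∘ev p)) (trans≈ assoc (∘-resp-≈ʳ (trans≈ P.pair-∘
      (P.pair-cong (trans≈ (∘-resp-≈ˡ (sym≈ (proj∘I₁-renaming (∈-++⁺ˡ {ys = ⟨0⟩}) (∈-map⁺ suc p)))) assoc)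
                   (trans≈ (∘-resp-≈ˡ (sym≈ (proj∘I₁-renaming (∈-++⁺ʳ B⁺) (here refl)))) assoc))))))

    I-exponential : IsExponential C.cat ⟦ ⟨0⟩ ⟧ ⟦ B ⟧ ⟦ B⁺ ⟧ ⟦ B⁺ ++ ⟨0⟩ ⟧ p₁ p₂ ev
    I-exponential = isExponential-fromCurry (I-product B⁺ ⟨0⟩) (_⊗ ⟦ ⟨0⟩ ⟧) π₁ π₂
                      (λ A → IsCartExp.product C.laws A ⟦ ⟨0⟩ ⟧) (curryᴮ B) curryᴮ-β curryᴮ-unique
      where
      curryᴮ-β : ∀ {A} (f : A ⊗ ⟦ ⟨0⟩ ⟧ ⇒ ⟦ B ⟧) h → p₁ ∘ h ≈ curryᴮ B f ∘ π₁ → p₂ ∘ h ≈ π₂ → ev ∘ h ≈ f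
      curryᴮ-β f h e₁ e₂ = proj-ext B _ _ λ p → begin
        proj p ∘ (ev ∘ h)
          ≈⟨ proj∘ev∘ h p ⟩
        eval ∘ ⟨ proj (∈-map⁺ suc p) ∘ (p₁ ∘ h) , π₁ ∘ (p₂ ∘ h) ⟩
          ≈⟨ ∘-resp-≈ʳ (P.pair-cong (trans≈ (∘-resp-≈ʳ e₁) (trans≈ sym-assoc (∘-resp-≈ˡ (proj∘curryᴮ B f p))))
                                    (∘-resp-≈ʳ e₂)) ⟩
        eval ∘ ⟨ curry ((proj p ∘ f) ∘ id×φ⁻¹) ∘ π₁ , π₁ ∘ π₂ ⟩
          ≈⟨ curry-β _ π₁ (π₁ ∘ π₂) ⟩
        ((proj p ∘ f) ∘ id×φ⁻¹) ∘ ⟨ π₁ , π₁ ∘ π₂ ⟩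
          ≈⟨ trans≈ assoc (trans≈ (∘-resp-≈ʳ id×φ⁻¹∘id×π₁) identityʳ) ⟩
        proj p ∘ f ∎
      curryᴮ-unique : ∀ {A} (f : A ⊗ ⟦ ⟨0⟩ ⟧ ⇒ ⟦ B ⟧) (g : A ⇒ ⟦ B⁺ ⟧) h →
                      p₁ ∘ h ≈ g ∘ π₁ → p₂ ∘ h ≈ π₂ → ev ∘ h ≈ f → g ≈ curryᴮ B f
      curryᴮ-unique f g h e₁ e₂ e₃ = proj-ext-map⁺ B _ _ λ p →
        let gₚ = proj (∈-map⁺ suc p) ∘ g
            fₚ : proj p ∘ f ≈ eval ∘ ⟨ gₚ ∘ π₁ , π₁ ∘ π₂ ⟩
            fₚ = trans≈ (∘-resp-≈ʳ (sym≈ e₃)) (trans≈ (proj∘ev∘ h p)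
                   (∘-resp-≈ʳ (P.pair-cong (trans≈ (∘-resp-≈ʳ e₁) sym-assoc) (∘-resp-≈ʳ e₂))))
            fₚ∘id×φ⁻¹ : eval ∘ ⟨ gₚ ∘ π₁ , π₂ ⟩ ≈ (proj p ∘ f) ∘ id×φ⁻¹
            fₚ∘id×φ⁻¹ = sym≈ (trans≈ (∘-resp-≈ˡ fₚ) (trans≈ assoc (∘-resp-≈ʳ (trans≈ P.pair-∘ (P.pair-cong
                          (pullʳ P.project₁)
                          (trans≈ (pullʳ P.project₂) (cancelˡ P.project₁)))))))
        in trans≈ (curry-unique gₚ fₚ∘id×φ⁻¹) (sym≈ (proj∘curryᴮ B f p))

  functor : CartExpFunctor 𝕄CE C
  functor = record
    { F₀       = ⟦_⟧
    ; F₁       = I₁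
    ; F-resp-≈ = λ { refl → refl≈ }
    ; F-id     = λ {A} → I₁-id {A}
    ; F-∘      = λ {_} {_} {_} {f} {g} → I₁-∘ f g
    ; pres-⊤   = IsCartExp.terminal C.laws
    ; pres-×   = I-product
    ; φ        = π₁
    ; φ⁻¹      = φ⁻¹
    ; φ-isoˡ   = φ⁻¹∘π₁
    ; φ-isoʳ   = P.project₁
    ; pres-⇨   = I-exponential
    }

lemma1 : 𝕄IsInitial
lemma1 = record
  { laws    = 𝕄-laws
  ; initial = λ C → Interpretation.functor C ,
                    λ F G → Transformation.transformation C F G , Transformation.unique C F G
  }
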